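{- Let $h\colon[n]\to[n]$ be a Hessenberg function and $w\in\mathfrak S_n$ a generator for $h$. If $u,v\in[w,w_0]$ satisfy $u\preceq_h v$, then $|E_{w,h}(u)|\le|E_{w,h}(v)|$. Furthermore, $|E_{w,h}(w)|\le|E_{w,h}(w_0)|$.
   Context: A Hessenberg function is a nondecreasing $h\colon[n]\to[n]$ with $h(i)\ge i$. For $u\in\mathfrak S_n$ (one-line notation) and $i<j$, $u(i,j)$ is obtained from $u$ by swapping the entries in positions $i$ and $j$. $\ell(u)$ is the number of inversions of $u$. The Bruhat order $\preceq$ is the reflexive–transitive closure of $u\prec u(i,j)$ when $\ell(u)<\ell(u(i,j))$; $w_0=n(n-1)\cdots1$ and $[w,w_0]=\{u\mid w\preceq u\preceq w_0\}$. The $h$-Bruhat order $\preceq_h$ is the reflexive–transitive closure of $u\prec_h u(i,j)$ when $i<j\le h(i)$ and $\ell(u(i,j))>\ell(u)$. A generator for $h$ is a $w\in\mathfrak S_n$ with $w^{ -1}(w(i)+1)\le h(i)$ for all $i$ with $w(i)\le n-1$. For $u\in[w,w_0]$, $E_{w,h}(u)=\{(i,j)\mid 1\le i<j\le h(i),\ u(i,j)\succeq w\}$; this is the set of edges at $u$ in the graph $\Gamma_{w,h}$, the subgraph induced on the vertex set $[w,w_0]$ of the graph $\Gamma_h$ with vertex set $\mathfrak S_n$ and edges $\{u,u(i,j)\}$ for $1\le i<j\le h(i)$. -}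

module Defs where

open import Data.Nat using (ℕ; zero; suc; _+_; _≤_; _<_; _<ᵇ_)
open import Data.Bool using (Bool; true; false; _∧_; if_then_else_)
open import Data.Fin using (Fin; toℕ; opposite)
open import Data.Fin.Permutation.Components using (transpose)
open import Data.Vec using (Vec; lookup; tabulate)
open import Data.List using (List; map; allFin)
open import Data.Nat.ListAction using (sum)
open import Data.Product using (Σ; _×_; _,_; proj₁; ∃-syntax)
open import Relation.Binary.PropositionalEquality using (_≡_)
open import Relation.Binary.Construct.Closure.ReflexiveTransitive using (Star)

-- Conventions: [n] is modelled by Fin n (0-based positions and values).
-- A word in one-line notation is a vector u with u(i) = lookup u i.

Word : ℕ → Set
Word n = Vec (Fin n) n

IsPerm : ∀ {n} → Word n → Set
IsPerm {n} u = (i j : Fin n) → lookup u i ≡ lookup u j → i ≡ j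

IsHessenberg : ∀ {n} → (Fin n → Fin n) → Set
IsHessenberg {n} h =
  ((i j : Fin n) → toℕ i ≤ toℕ j → toℕ (h i) ≤ toℕ (h j)) ×
  ((i : Fin n) → toℕ i ≤ toℕ (h i))

swap : ∀ {n} → Word n → Fin n → Fin n → Word n
swap u i j = tabulate (λ k → lookup u (transpose i j k))

inv : ∀ {n} → Word n → ℕ
inv {n} u = sum (map (λ i → sum (map (λ j →
  if (toℕ i <ᵇ toℕ j) ∧ (toℕ (lookup u j) <ᵇ toℕ (lookup u i)) then 1 else 0)
  (allFin n))) (allFin n))

w₀ : ∀ {n} → Word n
w₀ = tabulate opposite

BruhatStep : ∀ {n} → Word n → Word n → Set
BruhatStep {n} u v = Σ (Fin n) λ i → Σ (Fin n) λ j →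
  (toℕ i < toℕ j) × (v ≡ swap u i j) × (inv u < inv v)

_≼_ : ∀ {n} → Word n → Word n → Set
_≼_ = Star BruhatStep

hBruhatStep : ∀ {n} → (Fin n → Fin n) → Word n → Word n → Set
hBruhatStep {n} h u v = Σ (Fin n) λ i → Σ (Fin n) λ j →
  (toℕ i < toℕ j) × (toℕ j ≤ toℕ (h i)) × (v ≡ swap u i j) × (inv u < inv v)

_≼[_]_ : ∀ {n} → Word n → (Fin n → Fin n) → Word n → Set
u ≼[ h ] v = Star (hBruhatStep h) u v

-- w is a generator for h: w⁻¹(w(i)+1) ≤ h(i) whenever w(i) ≤ n-1 (1-based).
-- Here w⁻¹(w(i)+1) = k is expressed as w(k) = w(i)+1 (w is a permutation).
IsGenerator : ∀ {n} → (Fin n → Fin n) → Word n → Set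
IsGenerator {n} h w = (i k : Fin n) →
  toℕ (lookup w k) ≡ suc (toℕ (lookup w i)) → toℕ k ≤ toℕ (h i)

Edge : ∀ {n} → Word n → (Fin n → Fin n) → Word n → Set
Edge {n} w h u = Σ (Fin n × Fin n) λ p →
  (toℕ (proj₁ p) < toℕ (Data.Product.proj₂ p)) ×
  (toℕ (Data.Product.proj₂ p) ≤ toℕ (h (proj₁ p))) ×
  (w ≼ swap u (proj₁ p) (Data.Product.proj₂ p))

-- |A| ≤ |B| for the finite sets E_{w,h}(u), E_{w,h}(v) of pairs:
-- an injection E_{w,h}(u) → E_{w,h}(v) (injective on the underlying pairs).
_≤card_ : ∀ {n} {w h} → (u v : Word n) → Set
_≤card_ {n} {w} {h} u v = Σ (Edge w h u → Edge w h v) λ f →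
  (a b : Edge w h u) → proj₁ (f a) ≡ proj₁ (f b) → proj₁ a ≡ proj₁ b

CardLe : ∀ {n} → Word n → (Fin n → Fin n) → Word n → Word n → Set
CardLe w h u v = _≤card_ {w = w} {h = h} u v

-- It suffices to treat a single h-step u ≺ₕ v = u(a,b), where u(a) < u(b), and to inject
-- E_{w,h}(u) into E_{w,h}(v): an edge (i,j) goes to itself when v(i,j) ⪰ w, and otherwise to its
-- image under the transposition (a b), which is then an edge of v. Edges disjoint from {a,b}, and
-- (a,b) itself, are kept. All Bruhat comparisons go through the rank (tableau) criterion, under
-- which an edge sharing one endpoint with {a,b} involves only three positions and three values;
-- those finitely many configurations are checked by evaluation. For the second claim, a generator
-- satisfies w ≼ₕ w₀: bring n, n-1, ..., 1 to the front in turn by adjacent h-steps. Such a step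
-- could only be blocked by a cut h(m) = m, but no cut separates a value on its left from that
-- value's successor; this holds for a generator and is preserved by the steps.

module Submission where

open import Defs
open import Data.Bool using (Bool; true; false; _∧_; if_then_else_; T)
open import Data.Bool.Properties using (T-≡; T-∧; ∧-identityʳ; ∧-zeroʳ)
open import Data.Empty using (⊥; ⊥-elim)
open import Data.Fin using (Fin; zero; suc; toℕ; fromℕ<; opposite; punchOut)
open import Data.Fin.Patterns using (0F; 1F; 2F)
open import Data.Fin.Permutation.Components using (transpose; transpose-inverse)
open import Data.Fin.Properties
  using (toℕ-injective; toℕ-fromℕ<; toℕ<n; opposite-prop; any?; all?; pigeonhole; punchOut-injective)
  renaming (_≟_ to _≟ᶠ_)
import Data.Fin.Properties as Finₚ
open import Data.List using (map; allFin)
import Data.List as List using (tabulate)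
open import Data.List.Properties using (map-tabulate)
open import Data.Nat using (ℕ; zero; suc; _+_; _∸_; _≤_; _<_; _<ᵇ_; _≤ᵇ_; _<?_; _≤?_; z≤n; s≤s)
open import Data.Nat.ListAction using () renaming (sum to sumˡ)
open import Data.Nat.Properties
open import Data.Product using (_×_; _,_; proj₁; proj₂; ∃-syntax)
import Data.Product
open import Data.Product.Properties using (,-injective)
open import Data.Sum using (_⊎_; inj₁; inj₂)
import Data.Sum as Sum
open import Data.Unit using (tt)
open import Data.Vec using (lookup; tabulate)
open import Data.Vec.Properties using (lookup∘tabulate; tabulate∘lookup; tabulate-cong; ≡-dec)
open import Data.Vec.Functional using (updateAt; _∷_; [])
open import Data.Vec.Functional.Properties using (updateAt-updates; updateAt-minimal)
open import Function using (_∘_; id; const; Equivalence)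
open Equivalence using (to; from)
open import Function.Definitions using (Injective)
open import Relation.Binary.Construct.Closure.ReflexiveTransitive using (ε; _◅_; _◅◅_)
open import Relation.Binary.Definitions using (tri<; tri≈; tri>)
open import Relation.Binary.PropositionalEquality
open import Relation.Nullary using (¬_; Dec; yes; no)
open import Relation.Nullary.Decidable
  using (dec-true; dec-false; decidable-stable; ¬?; T?; _→-dec_; _×-dec_; _⊎-dec_; from-yes)

open import Algebra.Properties.CommutativeSemigroup +-commutativeSemigroup using (x∙yz≈y∙xz; xy∙z≈zy∙x)
open import Algebra.Properties.CommutativeMonoid.Sum +-0-commutativeMonoid
  using (sum; sum-cong-≗; ∑-distrib-+; sum-replicate-zero)

sum-mono-≤ : ∀ {n} {f g : Fin n → ℕ} → (∀ s → f s ≤ g s) → sum f ≤ sum g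
sum-mono-≤ {zero}  f≤g = z≤n
sum-mono-≤ {suc n} f≤g = +-mono-≤ (f≤g zero) (sum-mono-≤ (f≤g ∘ suc))

zeroAt : ∀ {n} → Fin n → (Fin n → ℕ) → Fin n → ℕ
zeroAt i f = updateAt f i (const 0)

sum-zeroAt : ∀ {n} (i : Fin n) (f : Fin n → ℕ) → sum f ≡ f i + sum (zeroAt i f)
sum-zeroAt zero    f = refl
sum-zeroAt (suc i) f = begin
  f zero + sum (f ∘ suc)                            ≡⟨ cong (f zero +_) (sum-zeroAt i (f ∘ suc)) ⟩
  f zero + (f (suc i) + sum (zeroAt i (f ∘ suc)))   ≡⟨ x∙yz≈y∙xz (f zero) (f (suc i)) _ ⟩
  f (suc i) + (f zero + sum (zeroAt i (f ∘ suc)))   ∎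
  where open ≡-Reasoning

Avoids : ∀ {m n} → (Fin m → Fin n) → Fin n → Set
Avoids pos s = ∀ x → pos x ≢ s

outside : ∀ {m n} → (Fin m → Fin n) → (Fin n → ℕ) → Fin n → ℕ
outside {zero}  pos f = f
outside {suc m} pos f = outside (pos ∘ suc) (zeroAt (pos zero) f)

sum-split-image : ∀ {m n} (pos : Fin m → Fin n) → Injective _≡_ _≡_ pos →
  ∀ f → sum f ≡ sum (f ∘ pos) + sum (outside pos f)
sum-split-image {zero}  pos inj f = refl
sum-split-image {suc m} pos inj f = begin
  sum f                                                  ≡⟨ sum-zeroAt (pos zero) f ⟩
  f (pos zero) + sum f′
    ≡⟨ cong (f (pos zero) +_) (sum-split-image (pos ∘ suc) (Finₚ.suc-injective ∘ inj) f′) ⟩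
  f (pos zero) + (sum (f′ ∘ pos ∘ suc) + sum (outside (pos ∘ suc) f′))
    ≡⟨ cong (λ t → f (pos zero) + (t + sum (outside (pos ∘ suc) f′))) (sum-cong-≗ f′-off) ⟩
  f (pos zero) + (sum (f ∘ pos ∘ suc) + sum (outside (pos ∘ suc) f′)) ≡⟨ sym (+-assoc (f (pos zero)) _ _) ⟩
  sum (f ∘ pos) + sum (outside pos f)                    ∎
  where
  open ≡-Reasoning
  f′ = zeroAt (pos zero) f
  f′-off : ∀ x → f′ (pos (suc x)) ≡ f (pos (suc x))
  f′-off x = updateAt-minimal (pos (suc x)) (pos zero) f (Finₚ.0≢1+n ∘ inj ∘ sym)

outside-pointwise : (R : ℕ → ℕ → Set) → R 0 0 → ∀ {m n} (pos : Fin m → Fin n) {f g : Fin n → ℕ} →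
  (∀ s → Avoids pos s → R (f s) (g s)) → ∀ s → R (outside pos f s) (outside pos g s)
outside-pointwise R R00 {zero}  pos fRg s = fRg s (λ ())
outside-pointwise R R00 {suc m} pos {f} {g} fRg = outside-pointwise R R00 (pos ∘ suc) f′Rg′
  where
  f′Rg′ : ∀ s → Avoids (pos ∘ suc) s → R (zeroAt (pos zero) f s) (zeroAt (pos zero) g s)
  f′Rg′ s avoids with pos zero ≟ᶠ s
  ... | yes refl = subst₂ R (sym (updateAt-updates s f)) (sym (updateAt-updates s g)) R00
  ... | no p₀≢s  = subst₂ R (sym (updateAt-minimal s (pos zero) f (p₀≢s ∘ sym)))
                            (sym (updateAt-minimal s (pos zero) g (p₀≢s ∘ sym)))
                            (fRg s λ { zero → p₀≢s ; (suc x) → avoids x })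

module _ {m n} (pos : Fin m → Fin n) (inj : Injective _≡_ _≡_ pos) {f g : Fin n → ℕ} where

  private
    split : ∀ f → sum f ≡ sum (f ∘ pos) + sum (outside pos f)
    split = sum-split-image pos inj

  sum-≤-byImage : (∀ s → Avoids pos s → f s ≤ g s) → sum (f ∘ pos) ≤ sum (g ∘ pos) → sum f ≤ sum g
  sum-≤-byImage off on = subst₂ _≤_ (sym (split f)) (sym (split g))
    (+-mono-≤ on (sum-mono-≤ (outside-pointwise _≤_ z≤n pos off)))

  sum-<-byImage : (∀ s → Avoids pos s → f s ≤ g s) → sum (f ∘ pos) < sum (g ∘ pos) → sum f < sum g
  sum-<-byImage off on = subst₂ _<_ (sym (split f)) (sym (split g))
    (+-mono-<-≤ on (sum-mono-≤ (outside-pointwise _≤_ z≤n pos off)))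

  sum-exchange-byImage : (∀ s → Avoids pos s → f s ≡ g s) →
    sum f + sum (g ∘ pos) ≡ sum g + sum (f ∘ pos)
  sum-exchange-byImage off = begin
    sum f + sum (g ∘ pos)                          ≡⟨ cong (_+ sum (g ∘ pos)) (split f) ⟩
    sum (f ∘ pos) + sum (outside pos f) + sum (g ∘ pos)
      ≡⟨ cong (λ t → sum (f ∘ pos) + t + sum (g ∘ pos)) (sum-cong-≗ (outside-pointwise _≡_ refl pos off)) ⟩
    sum (f ∘ pos) + sum (outside pos g) + sum (g ∘ pos) ≡⟨ xy∙z≈zy∙x (sum (f ∘ pos)) _ _ ⟩
    sum (g ∘ pos) + sum (outside pos g) + sum (f ∘ pos) ≡⟨ cong (_+ sum (f ∘ pos)) (sym (split g)) ⟩
    sum g + sum (f ∘ pos)                          ∎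
    where open ≡-Reasoning

pair-injective : ∀ {n} {i j : Fin n} → i ≢ j → Injective _≡_ _≡_ (i ∷ j ∷ [])
pair-injective i≢j {zero}       {zero}       _ = refl
pair-injective i≢j {zero}       {suc zero}   e = ⊥-elim (i≢j e)
pair-injective i≢j {suc zero}   {zero}       e = ⊥-elim (i≢j (sym e))
pair-injective i≢j {suc zero}   {suc zero}   _ = refl

module _ {n} {f g : Fin n → ℕ} where

  sum-<-at : ∀ i → (∀ s → f s ≤ g s) → f i < g i → sum f < sum g
  sum-<-at i f≤g fi<gi = sum-<-byImage (i ∷ []) (λ { {zero} {zero} _ → refl }) (λ s _ → f≤g s)
    (+-monoˡ-< 0 fi<gi)

  module _ {i j : Fin n} (i≢j : i ≢ j) where

    private
      avoids : ∀ {s} → Avoids (i ∷ j ∷ []) s → s ≢ i × s ≢ j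
      avoids a = (λ e → a zero (sym e)) , (λ e → a (suc zero) (sym e))

      pair-sum : ∀ (f : Fin n → ℕ) → sum (f ∘ (i ∷ j ∷ [])) ≡ f i + f j
      pair-sum f = cong (f i +_) (+-identityʳ (f j))

    sum-≤-at₂ : (∀ s → s ≢ i → s ≢ j → f s ≤ g s) → f i + f j ≤ g i + g j → sum f ≤ sum g
    sum-≤-at₂ off on = sum-≤-byImage _ (pair-injective i≢j) (λ s a → off s (proj₁ (avoids a)) (proj₂ (avoids a)))
      (subst₂ _≤_ (sym (pair-sum f)) (sym (pair-sum g)) on)

    sum-<-at₂ : (∀ s → s ≢ i → s ≢ j → f s ≤ g s) → f i + f j < g i + g j → sum f < sum g
    sum-<-at₂ off on = sum-<-byImage _ (pair-injective i≢j) (λ s a → off s (proj₁ (avoids a)) (proj₂ (avoids a)))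
      (subst₂ _<_ (sym (pair-sum f)) (sym (pair-sum g)) on)

    sum-exchange-at₂ : (∀ s → s ≢ i → s ≢ j → f s ≡ g s) → sum f + (g i + g j) ≡ sum g + (f i + f j)
    sum-exchange-at₂ off = subst₂ (λ a b → sum f + a ≡ sum g + b) (pair-sum g) (pair-sum f)
      (sum-exchange-byImage _ (pair-injective i≢j) (λ s a → off s (proj₁ (avoids a)) (proj₂ (avoids a))))

val : ∀ {n} → Word n → Fin n → ℕ
val u s = toℕ (lookup u s)

module _ {n} (i j : Fin n) where

  transpose-matchˡ : transpose i j i ≡ j
  transpose-matchˡ rewrite dec-true (i ≟ᶠ i) refl = refl

  transpose-matchʳ : transpose i j j ≡ i
  transpose-matchʳ with j ≟ᶠ i
  ... | yes j≡i = j≡i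
  ... | no  _   rewrite dec-true (j ≟ᶠ j) refl = refl

  transpose-other : ∀ {k} → k ≢ i → k ≢ j → transpose i j k ≡ k
  transpose-other {k} k≢i k≢j rewrite dec-false (k ≟ᶠ i) k≢i | dec-false (k ≟ᶠ j) k≢j = refl

transpose-comm : ∀ {n} (i j k : Fin n) → transpose i j k ≡ transpose j i k
transpose-comm i j k = by-cases (k ≟ᶠ i) (k ≟ᶠ j)
  where
  by-cases : Dec (k ≡ i) → Dec (k ≡ j) → transpose i j k ≡ transpose j i k
  by-cases (yes refl) (yes refl) = refl
  by-cases (yes refl) (no k≢j)   = trans (transpose-matchˡ k j) (sym (transpose-matchʳ j k))
  by-cases (no k≢i)   (yes refl) = trans (transpose-matchʳ i k) (sym (transpose-matchˡ k i))
  by-cases (no k≢i)   (no k≢j)   = trans (transpose-other i j k≢i k≢j) (sym (transpose-other j i k≢j k≢i))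

module _ {n} (i j : Fin n) where

  transpose-involutive : ∀ k → transpose i j (transpose i j k) ≡ k
  transpose-involutive k = trans (cong (transpose i j) (transpose-comm i j k)) (transpose-inverse i j)

  transpose-injective : Injective _≡_ _≡_ (transpose i j)
  transpose-injective {a} {b} e =
    trans (sym (transpose-involutive a)) (trans (cong (transpose i j) e) (transpose-involutive b))

transpose-commute : ∀ {n} {a b i j : Fin n} → a ≢ i → a ≢ j → b ≢ i → b ≢ j →
  ∀ s → transpose a b (transpose i j s) ≡ transpose i j (transpose a b s)
transpose-commute {a = a} {b} {i} {j} a≢i a≢j b≢i b≢j s = by-cases (s ≟ᶠ a) (s ≟ᶠ b) (s ≟ᶠ i) (s ≟ᶠ j)
  where
  by-cases : Dec (s ≡ a) → Dec (s ≡ b) → Dec (s ≡ i) → Dec (s ≡ j) →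
    transpose a b (transpose i j s) ≡ transpose i j (transpose a b s)
  by-cases (yes refl) _ _ _ rewrite transpose-other i j a≢i a≢j | transpose-matchˡ s b
    | transpose-other i j b≢i b≢j = refl
  by-cases (no s≢a) (yes refl) _ _ rewrite transpose-other i j b≢i b≢j | transpose-matchʳ a s
    | transpose-other i j a≢i a≢j = refl
  by-cases (no s≢a) (no s≢b) (yes refl) _ rewrite transpose-matchˡ s j | transpose-other a b s≢a s≢b
    | transpose-other a b (a≢j ∘ sym) (b≢j ∘ sym) | transpose-matchˡ s j = refl
  by-cases (no s≢a) (no s≢b) (no s≢i) (yes refl) rewrite transpose-matchʳ i s | transpose-other a b s≢a s≢b
    | transpose-other a b (a≢i ∘ sym) (b≢i ∘ sym) | transpose-matchʳ i s = refl
  by-cases (no s≢a) (no s≢b) (no s≢i) (no s≢j) rewrite transpose-other i j s≢i s≢j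
    | transpose-other a b s≢a s≢b | transpose-other i j s≢i s≢j = refl

word-ext : ∀ {n} {u v : Word n} → (∀ s → lookup u s ≡ lookup v s) → u ≡ v
word-ext {u = u} {v} e = trans (sym (tabulate∘lookup u)) (trans (tabulate-cong e) (tabulate∘lookup v))

module _ {n} (u : Word n) (i j : Fin n) where

  lookup-swap : ∀ k → lookup (swap u i j) k ≡ lookup u (transpose i j k)
  lookup-swap k = lookup∘tabulate _ k

  swap-comm : swap u i j ≡ swap u j i
  swap-comm = word-ext λ k →
    trans (lookup-swap k) (trans (cong (lookup u) (transpose-comm i j k)) (sym (lookup∘tabulate _ k)))

  swap-involutive : swap (swap u i j) i j ≡ u
  swap-involutive = word-ext λ k →
    trans (lookup∘tabulate _ k) (trans (lookup-swap (transpose i j k)) (cong (lookup u) (transpose-involutive i j k)))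

  val-swapˡ : val (swap u i j) i ≡ val u j
  val-swapˡ = cong toℕ (trans (lookup-swap i) (cong (lookup u) (transpose-matchˡ i j)))

  val-swapʳ : val (swap u i j) j ≡ val u i
  val-swapʳ = cong toℕ (trans (lookup-swap j) (cong (lookup u) (transpose-matchʳ i j)))

  val-swap-other : ∀ {k} → k ≢ i → k ≢ j → val (swap u i j) k ≡ val u k
  val-swap-other k≢i k≢j = cong toℕ (trans (lookup-swap _) (cong (lookup u) (transpose-other i j k≢i k≢j)))

IsPerm-swap : ∀ {n} (u : Word n) i j → IsPerm u → IsPerm (swap u i j)
IsPerm-swap u i j perm a b e =
  transpose-injective i j (perm _ _ (trans (sym (lookup-swap u i j a)) (trans e (lookup-swap u i j b))))

val-injective : ∀ {n} (u : Word n) → IsPerm u → ∀ {a b} → val u a ≡ val u b → a ≡ b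
val-injective u perm e = perm _ _ (toℕ-injective e)

<⇒≢ᶠ : ∀ {n} {a b : Fin n} → toℕ a < toℕ b → a ≢ b
<⇒≢ᶠ a<b refl = <-irrefl refl a<b

>⇒≢ᶠ : ∀ {n} {a b : Fin n} → toℕ b < toℕ a → a ≢ b
>⇒≢ᶠ b<a refl = <-irrefl refl b<a

𝟙 : Bool → ℕ
𝟙 b = if b then 1 else 0

𝟙-mono : ∀ {a b} → (T a → T b) → 𝟙 a ≤ 𝟙 b
𝟙-mono {false}         _   = z≤n
𝟙-mono {true}  {true}  _   = ≤-refl
𝟙-mono {true}  {false} a⇒b = ⊥-elim (a⇒b tt)

¬T⇒≡false : ∀ {b} → ¬ T b → b ≡ false
¬T⇒≡false {true}  ¬t = ⊥-elim (¬t tt)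
¬T⇒≡false {false} _  = refl

<ᵇ-true : ∀ {a b} → a < b → (a <ᵇ b) ≡ true
<ᵇ-true = to T-≡ ∘ <⇒<ᵇ

<ᵇ-false : ∀ {a b} → b ≤ a → (a <ᵇ b) ≡ false
<ᵇ-false {a} {b} b≤a = ¬T⇒≡false (λ t → <⇒≱ (<ᵇ⇒< a b t) b≤a)

≤ᵇ-true : ∀ {a b} → a ≤ b → (a ≤ᵇ b) ≡ true
≤ᵇ-true = to T-≡ ∘ ≤⇒≤ᵇ

≤ᵇ-false : ∀ {a b} → b < a → (a ≤ᵇ b) ≡ false
≤ᵇ-false {a} {b} b<a = ¬T⇒≡false (λ t → <⇒≱ b<a (≤ᵇ⇒≤ a b t))

inversion : ∀ {n} → Word n → Fin n → Fin n → ℕ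
inversion u s t = 𝟙 ((toℕ s <ᵇ toℕ t) ∧ (val u t <ᵇ val u s))

private
  sumˡ-tabulate : ∀ {n} (f : Fin n → ℕ) → sumˡ (List.tabulate f) ≡ sum f
  sumˡ-tabulate {zero}  f = refl
  sumˡ-tabulate {suc n} f = cong (f zero +_) (sumˡ-tabulate (f ∘ suc))

  sumˡ-allFin : ∀ {n} (f : Fin n → ℕ) → sumˡ (map f (allFin n)) ≡ sum f
  sumˡ-allFin f = trans (cong sumˡ (map-tabulate (λ x → x) f)) (sumˡ-tabulate f)

inv≡∑inversion : ∀ {n} (u : Word n) → inv u ≡ sum (λ s → sum (inversion u s))
inv≡∑inversion {n} u =
  trans (sumˡ-allFin (λ s → sumˡ (map (inversion u s) (allFin n)))) (sum-cong-≗ λ s → sumˡ-allFin (inversion u s))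

-- Counted row by row: rows other than i and j lose no inversions, and rows i and j together gain
-- one, the pair (i, j) itself.
module _ {n} (u : Word n) {i j : Fin n} (i<j : toℕ i < toℕ j) (uᵢ<uⱼ : val u i < val u j) where

  private
    u′ = swap u i j
    i≢j = <⇒≢ᶠ i<j

    inversion-other : ∀ s t → s ≢ i → s ≢ j → t ≢ i → t ≢ j → inversion u s t ≡ inversion u′ s t
    inversion-other s t s≢i s≢j t≢i t≢j
      rewrite val-swap-other u i j s≢i s≢j | val-swap-other u i j t≢i t≢j = refl

    row-other : ∀ s → s ≢ i → s ≢ j → sum (inversion u s) ≤ sum (inversion u′ s)
    row-other s s≢i s≢j with <-cmp (toℕ s) (toℕ i) | <-cmp (toℕ s) (toℕ j)
    ... | tri≈ _ s≡i _ | _ = ⊥-elim (s≢i (toℕ-injective s≡i))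
    ... | _ | tri≈ _ s≡j _ = ⊥-elim (s≢j (toℕ-injective s≡j))
    ... | tri< s<i _ _ | tri> _ _ j<s = ⊥-elim (<-asym (<-trans s<i i<j) j<s)
    ... | tri< s<i _ _ | tri< s<j _ _ =
      sum-≤-at₂ i≢j (λ t t≢i t≢j → ≤-reflexive (inversion-other s t s≢i s≢j t≢i t≢j)) swapped
      where
      swapped : inversion u s i + inversion u s j ≤ inversion u′ s i + inversion u′ s j
      swapped rewrite val-swapˡ u i j | val-swapʳ u i j | val-swap-other u i j s≢i s≢j
                    | <ᵇ-true s<i | <ᵇ-true s<j = ≤-reflexive (+-comm (𝟙 (val u i <ᵇ val u s)) _)
    ... | tri> _ _ i<s | tri< s<j _ _ = sum-mono-≤ pointwise
      where
      pointwise : ∀ t → inversion u s t ≤ inversion u′ s t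
      pointwise t with t ≟ᶠ i | t ≟ᶠ j
      ... | yes refl | _ rewrite <ᵇ-false (<⇒≤ i<s) = z≤n
      ... | no t≢i | yes refl rewrite val-swapʳ u i j | val-swap-other u i j s≢i s≢j | <ᵇ-true s<j =
        𝟙-mono (λ uⱼ<uₛ → <⇒<ᵇ (<-trans uᵢ<uⱼ (<ᵇ⇒< (val u j) (val u s) uⱼ<uₛ)))
      ... | no t≢i | no t≢j = ≤-reflexive (inversion-other s t s≢i s≢j t≢i t≢j)
    ... | tri> _ _ i<s | tri> _ _ j<s = sum-mono-≤ pointwise
      where
      pointwise : ∀ t → inversion u s t ≤ inversion u′ s t
      pointwise t with t ≟ᶠ i | t ≟ᶠ j
      ... | yes refl | _ rewrite <ᵇ-false (<⇒≤ i<s) = z≤n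
      ... | no t≢i | yes refl rewrite <ᵇ-false (<⇒≤ j<s) = z≤n
      ... | no t≢i | no t≢j = ≤-reflexive (inversion-other s t s≢i s≢j t≢i t≢j)

    rows-ij : sum (inversion u i) + sum (inversion u j) < sum (inversion u′ i) + sum (inversion u′ j)
    rows-ij = subst₂ _<_ (∑-distrib-+ (inversion u i) (inversion u j))
                         (∑-distrib-+ (inversion u′ i) (inversion u′ j))
                         (sum-<-at j pointwise at-j)
      where
      at-j : inversion u i j + inversion u j j < inversion u′ i j + inversion u′ j j
      at-j rewrite val-swapˡ u i j | val-swapʳ u i j | <ᵇ-true i<j | <ᵇ-false (≤-refl {toℕ j})
                 | <ᵇ-false (<⇒≤ uᵢ<uⱼ) | <ᵇ-true uᵢ<uⱼ = s≤s z≤n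
      pointwise : ∀ t → inversion u i t + inversion u j t ≤ inversion u′ i t + inversion u′ j t
      pointwise t with t ≟ᶠ i | t ≟ᶠ j
      ... | yes refl | _ rewrite <ᵇ-false (≤-refl {toℕ t}) | <ᵇ-false (<⇒≤ i<j) = z≤n
      ... | no t≢i | yes refl = <⇒≤ at-j
      ... | no t≢i | no t≢j rewrite val-swapˡ u i j | val-swapʳ u i j | val-swap-other u i j t≢i t≢j
        with <-cmp (toℕ t) (toℕ i) | <-cmp (toℕ t) (toℕ j)
      ... | tri≈ _ t≡i _ | _ = ⊥-elim (t≢i (toℕ-injective t≡i))
      ... | _ | tri≈ _ t≡j _ = ⊥-elim (t≢j (toℕ-injective t≡j))
      ... | tri< t<i _ _ | _ rewrite <ᵇ-false (<⇒≤ t<i) | <ᵇ-false (<⇒≤ (<-trans t<i i<j)) = z≤n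
      ... | tri> _ _ i<t | tri< t<j _ _ rewrite <ᵇ-true i<t | <ᵇ-false (<⇒≤ t<j) =
        +-monoˡ-≤ 0 (𝟙-mono (λ uₜ<uᵢ → <⇒<ᵇ (<-trans (<ᵇ⇒< (val u t) (val u i) uₜ<uᵢ) uᵢ<uⱼ)))
      ... | tri> _ _ i<t | tri> _ _ j<t rewrite <ᵇ-true i<t | <ᵇ-true j<t =
        ≤-reflexive (+-comm (𝟙 (val u t <ᵇ val u i)) _)

  inv-swap-< : inv u < inv (swap u i j)
  inv-swap-< rewrite inv≡∑inversion u | inv≡∑inversion u′ = sum-<-at₂ i≢j row-other rows-ij

-- The rank criterion for the Bruhat order

-- rank u p k = #{s ≤ p | u(s) ≥ k}. On permutations, x ≼ y iff x ⊑ y (the tableau criterion).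
rankTerm : ∀ {n} → Word n → Fin n → ℕ → Fin n → ℕ
rankTerm u p k s = 𝟙 ((toℕ s ≤ᵇ toℕ p) ∧ (k ≤ᵇ val u s))

rank : ∀ {n} → Word n → Fin n → ℕ → ℕ
rank u p k = sum (rankTerm u p k)

infix 4 _⊑_
record _⊑_ {n} (x y : Word n) : Set where
  constructor rank-dominated
  field rank-≤ : ∀ p k → rank x p k ≤ rank y p k
open _⊑_ public

⊑-refl : ∀ {n} {x : Word n} → x ⊑ x
⊑-refl = rank-dominated λ p k → ≤-refl

⊑-trans : ∀ {n} {x y z : Word n} → x ⊑ y → y ⊑ z → x ⊑ z
⊑-trans x⊑y y⊑z = rank-dominated λ p k → ≤-trans (rank-≤ x⊑y p k) (rank-≤ y⊑z p k)

≤ᵇ-mono : ∀ k {a b} → a ≤ b → T (k ≤ᵇ a) → T (k ≤ᵇ b)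
≤ᵇ-mono k {a} a≤b t = ≤⇒≤ᵇ (≤-trans (≤ᵇ⇒≤ k a t) a≤b)

≤ᵇ-antitone : ∀ {n} (p : Fin n) {i j : Fin n} → toℕ i < toℕ j → T (toℕ j ≤ᵇ toℕ p) → T (toℕ i ≤ᵇ toℕ p)
≤ᵇ-antitone p {i} {j} i<j t = ≤⇒≤ᵇ (≤-trans (<⇒≤ i<j) (≤ᵇ⇒≤ (toℕ j) (toℕ p) t))

𝟙-rearrangement : ∀ bᵢ bⱼ cᵢ cⱼ → (T bⱼ → T bᵢ) → (T cᵢ → T cⱼ) →
  𝟙 (bᵢ ∧ cᵢ) + 𝟙 (bⱼ ∧ cⱼ) ≤ 𝟙 (bᵢ ∧ cⱼ) + 𝟙 (bⱼ ∧ cᵢ)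
𝟙-rearrangement true  true  true  true  _ _ = ≤-refl
𝟙-rearrangement true  true  true  false _ c = ⊥-elim (c tt)
𝟙-rearrangement true  true  false true  _ _ = ≤-refl
𝟙-rearrangement true  true  false false _ _ = ≤-refl
𝟙-rearrangement true  false true  true  _ _ = ≤-refl
𝟙-rearrangement true  false true  false _ c = ⊥-elim (c tt)
𝟙-rearrangement true  false false true  _ _ = z≤n
𝟙-rearrangement true  false false false _ _ = ≤-refl
𝟙-rearrangement false true  _     _     b _ = ⊥-elim (b tt)
𝟙-rearrangement false false _     _     _ _ = ≤-refl

𝟙-rearrangement-gap : ∀ bᵢ bⱼ cᵢ cⱼ → (T bⱼ → T bᵢ) → (T cᵢ → T cⱼ) →
  (𝟙 (bᵢ ∧ cⱼ) + 𝟙 (bⱼ ∧ cᵢ) ≤ 𝟙 (bᵢ ∧ cᵢ) + 𝟙 (bⱼ ∧ cⱼ)) ⊎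
  (T bᵢ × ¬ T bⱼ × ¬ T cᵢ × T cⱼ × (𝟙 (bᵢ ∧ cⱼ) + 𝟙 (bⱼ ∧ cᵢ) ≡ suc (𝟙 (bᵢ ∧ cᵢ) + 𝟙 (bⱼ ∧ cⱼ))))
𝟙-rearrangement-gap true  true  true  true  _ _ = inj₁ ≤-refl
𝟙-rearrangement-gap true  true  true  false _ c = ⊥-elim (c tt)
𝟙-rearrangement-gap true  true  false true  _ _ = inj₁ ≤-refl
𝟙-rearrangement-gap true  true  false false _ _ = inj₁ ≤-refl
𝟙-rearrangement-gap true  false true  true  _ _ = inj₁ ≤-refl
𝟙-rearrangement-gap true  false true  false _ c = ⊥-elim (c tt)
𝟙-rearrangement-gap true  false false true  _ _ = inj₂ (tt , (λ ()) , (λ ()) , tt , refl)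
𝟙-rearrangement-gap true  false false false _ _ = inj₁ ≤-refl
𝟙-rearrangement-gap false true  _     _     b _ = ⊥-elim (b tt)
𝟙-rearrangement-gap false false _     _     _ _ = inj₁ z≤n

module _ {n} (u : Word n) {i j : Fin n} (i<j : toℕ i < toℕ j) where

  rankTerm-swap-other : ∀ p k {s} → s ≢ i → s ≢ j → rankTerm (swap u i j) p k s ≡ rankTerm u p k s
  rankTerm-swap-other p k s≢i s≢j rewrite val-swap-other u i j s≢i s≢j = refl

  rank-swap-exchange : ∀ p k →
    rank (swap u i j) p k + (rankTerm u p k i + rankTerm u p k j) ≡
    rank u p k + (𝟙 ((toℕ i ≤ᵇ toℕ p) ∧ (k ≤ᵇ val u j)) + 𝟙 ((toℕ j ≤ᵇ toℕ p) ∧ (k ≤ᵇ val u i)))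
  rank-swap-exchange p k =
    subst (λ t → rank (swap u i j) p k + (rankTerm u p k i + rankTerm u p k j) ≡ rank u p k + t)
      (cong₂ (λ a b → 𝟙 ((toℕ i ≤ᵇ toℕ p) ∧ (k ≤ᵇ a)) + 𝟙 ((toℕ j ≤ᵇ toℕ p) ∧ (k ≤ᵇ b)))
             (val-swapˡ u i j) (val-swapʳ u i j))
      (sum-exchange-at₂ (<⇒≢ᶠ i<j) (λ s s≢i s≢j → rankTerm-swap-other p k s≢i s≢j))

  ⊑-swap : val u i < val u j → u ⊑ swap u i j
  ⊑-swap uᵢ<uⱼ = rank-dominated λ p k →
    sum-≤-at₂ (<⇒≢ᶠ i<j) (λ s s≢i s≢j → ≤-reflexive (sym (rankTerm-swap-other p k s≢i s≢j))) (on-ij p k)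
    where
    on-ij : ∀ p k → rankTerm u p k i + rankTerm u p k j ≤ rankTerm (swap u i j) p k i + rankTerm (swap u i j) p k j
    on-ij p k rewrite val-swapˡ u i j | val-swapʳ u i j =
      𝟙-rearrangement (toℕ i ≤ᵇ toℕ p) (toℕ j ≤ᵇ toℕ p) (k ≤ᵇ val u i) (k ≤ᵇ val u j)
        (≤ᵇ-antitone p i<j) (≤ᵇ-mono k (<⇒≤ uᵢ<uⱼ))

  inv-swap-<⇒val< : IsPerm u → inv u < inv (swap u i j) → val u i < val u j
  inv-swap-<⇒val< perm inv< with <-cmp (val u i) (val u j)
  ... | tri< uᵢ<uⱼ _ _ = uᵢ<uⱼ
  ... | tri≈ _ uᵢ≡uⱼ _ = ⊥-elim (<⇒≢ᶠ i<j (val-injective u perm uᵢ≡uⱼ))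
  ... | tri> _ _ uⱼ<uᵢ = ⊥-elim (<-asym inv< (subst (λ z → inv (swap u i j) < inv z) (swap-involutive u i j)
          (inv-swap-< (swap u i j) i<j (subst₂ _<_ (sym (val-swapˡ u i j)) (sym (val-swapʳ u i j)) uⱼ<uᵢ))))

IsPerm-≼ : ∀ {n} {x y : Word n} → IsPerm x → x ≼ y → IsPerm y
IsPerm-≼ perm ε = perm
IsPerm-≼ {x = x} perm ((i , j , _ , refl , _) ◅ x≼y) = IsPerm-≼ (IsPerm-swap x i j perm) x≼y

≼⇒⊑ : ∀ {n} {x y : Word n} → IsPerm x → x ≼ y → x ⊑ y
≼⇒⊑ perm ε = ⊑-refl
≼⇒⊑ {x = x} perm ((i , j , i<j , refl , inv<) ◅ x≼y) =
  ⊑-trans (⊑-swap x i<j (inv-swap-<⇒val< x i<j perm inv<)) (≼⇒⊑ (IsPerm-swap x i j perm) x≼y)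

bruhatStep : ∀ {n} (x : Word n) {i j : Fin n} → toℕ i < toℕ j → val x i < val x j → BruhatStep x (swap x i j)
bruhatStep x {i} {j} i<j xᵢ<xⱼ = i , j , i<j , refl , inv-swap-< x i<j xᵢ<xⱼ

IsPerm⇒surjective : ∀ {n} (x : Word n) → IsPerm x → ∀ c → ∃[ s ] lookup x s ≡ c
IsPerm⇒surjective {suc m} x perm c with any? (λ s → lookup x s ≟ᶠ c)
... | yes hit = hit
... | no miss with pigeonhole (≤-refl {suc m}) (λ s → punchOut {i = c} {j = lookup x s} (λ e → miss (s , sym e)))
... | a , b , a<b , e =
  ⊥-elim (<⇒≢ᶠ a<b (perm a b (punchOut-injective {i = c} (λ e → miss (a , sym e)) (λ e → miss (b , sym e)) e)))

least-witness : ∀ {n} (P : Fin n → Set) → (∀ s → Dec (P s)) → ∃[ s ] P s →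
  ∃[ s ] (P s × (∀ t → toℕ t < toℕ s → ¬ P t))
least-witness {suc n} P P? (s₀ , ps₀) with P? zero
... | yes p0 = zero , p0 , λ t ()
... | no ¬p0 with s₀
...   | zero   = ⊥-elim (¬p0 ps₀)
...   | suc s₁ with least-witness (P ∘ suc) (P? ∘ suc) (s₁ , ps₀)
...     | s , ps , below = suc s , ps , below′
  where
  below′ : ∀ t → toℕ t < toℕ (suc s) → ¬ P t
  below′ zero    _         = ¬p0
  below′ (suc t) (s≤s t<s) = below t t<s

first-difference : ∀ {n} (x y : Word n) → x ≢ y →
  ∃[ i ] (lookup x i ≢ lookup y i × (∀ t → toℕ t < toℕ i → lookup x t ≡ lookup y t))
first-difference x y x≢y =
  let i , xᵢ≢yᵢ , below = least-witness (λ s → lookup x s ≢ lookup y s) differ? differs-somewhere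
  in  i , xᵢ≢yᵢ , λ t t<i → decidable-stable (lookup x t ≟ᶠ lookup y t) (below t t<i)
  where
  differ? : ∀ s → Dec (lookup x s ≢ lookup y s)
  differ? s = ¬? (lookup x s ≟ᶠ lookup y s)
  differs-somewhere : ∃[ s ] (lookup x s ≢ lookup y s)
  differs-somewhere with any? differ?
  ... | yes d = d
  ... | no nd = ⊥-elim (x≢y (word-ext λ s → decidable-stable (lookup x s ≟ᶠ lookup y s) (λ ne → nd (s , ne))))

countBetween : ∀ {n} → Word n → Fin n → ℕ → ℕ → ℕ
countBetween z p k m = sum (λ s → 𝟙 ((toℕ s ≤ᵇ toℕ p) ∧ ((k ≤ᵇ val z s) ∧ (val z s ≤ᵇ m))))

rank-split : ∀ {n} (z : Word n) p k m → k ≤ suc m → rank z p k ≡ rank z p (suc m) + countBetween z p k m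
rank-split z p k m k≤1+m = trans (sum-cong-≗ pointwise) (∑-distrib-+ (rankTerm z p (suc m)) _)
  where
  pointwise : ∀ s → rankTerm z p k s ≡
    rankTerm z p (suc m) s + 𝟙 ((toℕ s ≤ᵇ toℕ p) ∧ ((k ≤ᵇ val z s) ∧ (val z s ≤ᵇ m)))
  pointwise s with toℕ s ≤ᵇ toℕ p
  ... | false = refl
  ... | true with val z s ≤? m
  ...   | yes zₛ≤m rewrite ≤ᵇ-true zₛ≤m | ≤ᵇ-false {suc m} (s≤s zₛ≤m) = cong 𝟙 (sym (∧-identityʳ _))
  ...   | no zₛ≰m rewrite ≤ᵇ-false (≰⇒> zₛ≰m) | ≤ᵇ-true {suc m} (≰⇒> zₛ≰m)
                        | ≤ᵇ-true {k} (≤-trans k≤1+m (≰⇒> zₛ≰m)) = refl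

rankDeficit : ∀ {n} → Word n → Word n → ℕ
rankDeficit {n} x y = sum (λ p → sum (λ (k : Fin n) → rank y p (toℕ k) ∸ rank x p (toℕ k)))

-- At the first position i where x ⊑ y differ, swap i with the leftmost j > i having x(i) < x(j) ≤ y(i):
-- this is a Bruhat step up that keeps x below y in rank and strictly shrinks the rank deficit.
module UpwardStep {n} (x y : Word n) (x-perm : IsPerm x) (y-perm : IsPerm y) (x⊑y : x ⊑ y)
  {i : Fin n} (xᵢ≢yᵢ : lookup x i ≢ lookup y i) (agree : ∀ t → toℕ t < toℕ i → lookup x t ≡ lookup y t) where

  xᵢ<yᵢ : val x i < val y i
  xᵢ<yᵢ with <-cmp (val x i) (val y i)
  ... | tri< lt _ _ = lt
  ... | tri≈ _ e _ = ⊥-elim (xᵢ≢yᵢ (toℕ-injective e))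
  ... | tri> _ _ yᵢ<xᵢ = ⊥-elim (<⇒≱ (sum-<-at i pointwise at-i) (rank-≤ x⊑y i (val x i)))
    where
    at-i : rankTerm y i (val x i) i < rankTerm x i (val x i) i
    at-i rewrite ≤ᵇ-true (≤-refl {toℕ i}) | ≤ᵇ-false yᵢ<xᵢ | ≤ᵇ-true (≤-refl {val x i}) = s≤s z≤n
    pointwise : ∀ s → rankTerm y i (val x i) s ≤ rankTerm x i (val x i) s
    pointwise s with <-cmp (toℕ s) (toℕ i)
    ... | tri< s<i _ _ rewrite agree s s<i = ≤-refl
    ... | tri≈ _ s≡i _ rewrite toℕ-injective s≡i = <⇒≤ at-i
    ... | tri> _ _ i<s rewrite ≤ᵇ-false i<s = z≤n

  Candidate : Fin n → Set
  Candidate t = (toℕ i < toℕ t) × (val x i < val x t) × (val x t ≤ val y i)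

  candidate? : ∀ t → Dec (Candidate t)
  candidate? t with toℕ i <? toℕ t | val x i <? val x t | val x t ≤? val y i
  ... | yes a | yes b | yes c = yes (a , b , c)
  ... | no ¬a | _     | _     = no (¬a ∘ proj₁)
  ... | yes _ | no ¬b | _     = no (¬b ∘ proj₁ ∘ proj₂)
  ... | yes _ | yes _ | no ¬c = no (¬c ∘ proj₂ ∘ proj₂)

  candidate-exists : ∃[ t ] Candidate t
  candidate-exists with IsPerm⇒surjective x x-perm (lookup y i)
  ... | t , xₜ≡yᵢ with <-cmp (toℕ t) (toℕ i)
  ...   | tri< t<i _ _ = ⊥-elim (<⇒≢ᶠ t<i (y-perm t i (trans (sym (agree t t<i)) xₜ≡yᵢ)))
  ...   | tri≈ _ t≡i _ = ⊥-elim (xᵢ≢yᵢ (subst (λ z → lookup x z ≡ lookup y i) (toℕ-injective t≡i) xₜ≡yᵢ))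
  ...   | tri> _ _ i<t = t , i<t , subst (val x i <_) (sym (cong toℕ xₜ≡yᵢ)) xᵢ<yᵢ , ≤-reflexive (cong toℕ xₜ≡yᵢ)

  private
    leastCandidate = least-witness Candidate candidate? candidate-exists

  j : Fin n
  j = proj₁ leastCandidate

  i<j : toℕ i < toℕ j
  i<j = proj₁ (proj₁ (proj₂ leastCandidate))

  xᵢ<xⱼ : val x i < val x j
  xᵢ<xⱼ = proj₁ (proj₂ (proj₁ (proj₂ leastCandidate)))

  xⱼ≤yᵢ : val x j ≤ val y i
  xⱼ≤yᵢ = proj₂ (proj₂ (proj₁ (proj₂ leastCandidate)))

  no-earlier-candidate : ∀ t → toℕ t < toℕ j → ¬ Candidate t
  no-earlier-candidate = proj₂ (proj₂ leastCandidate)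

  x′ : Word n
  x′ = swap x i j

  step : BruhatStep x x′
  step = bruhatStep x i<j xᵢ<xⱼ

  rank-<-window : ∀ p k → toℕ i ≤ toℕ p → toℕ p < toℕ j → val x i < k → k ≤ val x j → rank x p k < rank y p k
  rank-<-window p k i≤p p<j xᵢ<k k≤xⱼ =
    subst₂ _<_ (sym (rank-split x p k m k≤1+m)) (sym (rank-split y p k m k≤1+m))
      (+-mono-≤-< (rank-≤ x⊑y p (suc m)) (sum-<-at i pointwise at-i))
    where
    m = val y i
    k≤1+m : k ≤ suc m
    k≤1+m = ≤-trans k≤xⱼ (≤-trans xⱼ≤yᵢ (n≤1+n m))
    between : Word n → Fin n → ℕ
    between z s = 𝟙 ((toℕ s ≤ᵇ toℕ p) ∧ ((k ≤ᵇ val z s) ∧ (val z s ≤ᵇ m)))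
    at-i : between x i < between y i
    at-i rewrite ≤ᵇ-true i≤p | ≤ᵇ-false {k} {val x i} xᵢ<k | ≤ᵇ-true (≤-trans k≤xⱼ xⱼ≤yᵢ) | ≤ᵇ-true (≤-refl {m}) = s≤s z≤n
    pointwise : ∀ s → between x s ≤ between y s
    pointwise s with <-cmp (toℕ s) (toℕ i)
    ... | tri< s<i _ _ rewrite agree s s<i = ≤-refl
    ... | tri≈ _ s≡i _ rewrite toℕ-injective s≡i = <⇒≤ at-i
    ... | tri> _ _ i<s = 𝟙-mono λ t →
      let s≤ᵇp , in-range = to T-∧ t
          k≤ᵇxₛ , xₛ≤ᵇm = to T-∧ in-range
      in ⊥-elim (no-earlier-candidate s (≤-<-trans (≤ᵇ⇒≤ _ _ s≤ᵇp) p<j)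
                   (i<s , <-≤-trans xᵢ<k (≤ᵇ⇒≤ _ _ k≤ᵇxₛ) , ≤ᵇ⇒≤ _ _ xₛ≤ᵇm))

  private
    exchange : ∀ p k → rank x′ p k + (rankTerm x p k i + rankTerm x p k j) ≡
      rank x p k + (𝟙 ((toℕ i ≤ᵇ toℕ p) ∧ (k ≤ᵇ val x j)) + 𝟙 ((toℕ j ≤ᵇ toℕ p) ∧ (k ≤ᵇ val x i)))
    exchange = rank-swap-exchange x i<j

    cancel-≤ : ∀ {a b c d} → a + c ≡ b + d → d ≤ c → a ≤ b
    cancel-≤ {a} {b} {c} e d≤c = +-cancelʳ-≤ c a b (subst (_≤ b + c) (sym e) (+-monoʳ-≤ b d≤c))

    cancel-suc : ∀ {a b c} → a + c ≡ b + suc c → a ≡ suc b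
    cancel-suc {a} {b} {c} e = +-cancelʳ-≡ c a (suc b) (trans e (+-suc b c))

  rank-x′≤y : ∀ p k → rank x′ p k ≤ rank y p k
  rank-x′≤y p k with 𝟙-rearrangement-gap (toℕ i ≤ᵇ toℕ p) (toℕ j ≤ᵇ toℕ p) (k ≤ᵇ val x i) (k ≤ᵇ val x j)
                                    (≤ᵇ-antitone p i<j) (≤ᵇ-mono k (<⇒≤ xᵢ<xⱼ))
  ... | inj₁ no-gain = ≤-trans (cancel-≤ (exchange p k) no-gain) (rank-≤ x⊑y p k)
  ... | inj₂ (i≤p , j≰p , k≰xᵢ , k≤xⱼ , gain) =
    subst (_≤ rank y p k) (sym (cancel-suc (trans (exchange p k) (cong (rank x p k +_) gain))))
      (rank-<-window p k (≤ᵇ⇒≤ _ _ i≤p) (≰⇒> (j≰p ∘ ≤⇒≤ᵇ)) (≰⇒> (k≰xᵢ ∘ ≤⇒≤ᵇ)) (≤ᵇ⇒≤ _ _ k≤xⱼ))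

  x′⊑y : x′ ⊑ y
  x′⊑y = rank-dominated rank-x′≤y

  deficit-< : rankDeficit x′ y < rankDeficit x y
  deficit-< =
    sum-<-at {n} i (λ p → sum-mono-≤ {n} (λ k → ∸-monoʳ-≤ (rank y p (toℕ k)) (rank-≤ x⊑x′ p (toℕ k))))
    (sum-<-at {n} (lookup x j) (λ k → ∸-monoʳ-≤ (rank y i (toℕ k)) (rank-≤ x⊑x′ i (toℕ k)))
      (∸-monoʳ-< (subst (rank x i (val x j) <_) (sym gain) (n<1+n _)) (rank-x′≤y i (val x j))))
    where
    x⊑x′ : x ⊑ x′
    x⊑x′ = ⊑-swap x i<j xᵢ<xⱼ
    gain : rank x′ i (val x j) ≡ suc (rank x i (val x j))
    gain = cancel-suc e
      where
      e : rank x′ i (val x j) + (rankTerm x i (val x j) i + rankTerm x i (val x j) j) ≡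
          rank x i (val x j) + suc (rankTerm x i (val x j) i + rankTerm x i (val x j) j)
      e with exchange i (val x j)
      ... | ex rewrite ≤ᵇ-true (≤-refl {toℕ i}) | ≤ᵇ-false i<j | ≤ᵇ-false xᵢ<xⱼ | ≤ᵇ-true (≤-refl {val x j}) = ex

⊑⇒≼ : ∀ {n} {x y : Word n} → IsPerm x → IsPerm y → x ⊑ y → x ≼ y
⊑⇒≼ {x = x} {y} x-perm y-perm x⊑y = go (rankDeficit x y) x x-perm x⊑y ≤-refl
  where
  go : ∀ bound x → IsPerm x → x ⊑ y → rankDeficit x y ≤ bound → x ≼ y
  go bound x x-perm x⊑y deficit≤ with ≡-dec _≟ᶠ_ x y
  ... | yes refl = ε
  ... | no x≢y with first-difference x y x≢y
  ... | i , xᵢ≢yᵢ , agree = climb bound deficit≤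
    where
    open UpwardStep x y x-perm y-perm x⊑y xᵢ≢yᵢ agree
    climb : ∀ bound → rankDeficit x y ≤ bound → x ≼ y
    climb zero    deficit≤0 = ⊥-elim (<⇒≱ deficit-< (≤-trans deficit≤0 z≤n))
    climb (suc b) deficit≤  = step ◅ go b x′ (IsPerm-swap x i j x-perm) x′⊑y (≤-pred (≤-trans deficit-< deficit≤))

≼-dec : ∀ {n} {x y : Word n} → IsPerm x → IsPerm y → Dec (x ≼ y)
≼-dec {n} {x} {y} x-perm y-perm
  with all? (λ (p : Fin n) → all? (λ (k : Fin n) → rank x p (toℕ k) ≤? rank y p (toℕ k)))
... | no ¬small = no (λ x≼y → ¬small (λ p k → rank-≤ (≼⇒⊑ x-perm x≼y) p (toℕ k)))
... | yes small = yes (⊑⇒≼ x-perm y-perm x⊑y)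
  where
  rank-vanishes : ∀ (z : Word n) p k → n ≤ k → rank z p k ≡ 0
  rank-vanishes z p k n≤k = trans (sum-cong-≗ pointwise) (sum-replicate-zero n)
    where
    pointwise : ∀ s → rankTerm z p k s ≡ 0
    pointwise s rewrite ≤ᵇ-false {k} (<-≤-trans (toℕ<n (lookup z s)) n≤k) = cong 𝟙 (∧-zeroʳ _)
  x⊑y : x ⊑ y
  x⊑y = rank-dominated rank-x≤y
    where
    rank-x≤y : ∀ p k → rank x p k ≤ rank y p k
    rank-x≤y p k with k <? n
    ... | yes k<n = subst (λ z → rank x p z ≤ rank y p z) (toℕ-fromℕ< k<n) (small p (fromℕ< k<n))
    ... | no k≮n rewrite rank-vanishes x p k (≮⇒≥ k≮n) = z≤n

-- A word that agrees with u except that it puts u(pos (π x)) at pos x (x : Fin 3) has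
-- rank p k = localRank π B C + (terms off the three positions), where B x = [pos x ≤ p] and
-- C x = [k ≤ u(pos x)]; B is a down-set for the position order and C an up-set for the value order.
Pattern : Set
Pattern = Fin 3 → Bool

localRank : (Fin 3 → Fin 3) → Pattern → Pattern → ℕ
localRank π B C = sum (λ x → 𝟙 (B x ∧ C (π x)))

-- An order of the three slots, given by the rank of each slot.
Downset : (Fin 3 → Fin 3) → Pattern → Set
Downset r B = ∀ x y → toℕ (r x) < toℕ (r y) → T (B y) → T (B x)

Upset : (Fin 3 → Fin 3) → Pattern → Set
Upset r C = ∀ x y → toℕ (r x) < toℕ (r y) → T (C x) → T (C y)

Covered : (π₁ π₂ ρ : Fin 3 → Fin 3) → Pattern → Pattern → Set
Covered π₁ π₂ ρ B C = localRank π₁ B C ≤ localRank ρ B C ⊎ localRank π₂ B C ≤ localRank ρ B C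

Dominated : (rP rV π₁ π₂ ρ : Fin 3 → Fin 3) → Set
Dominated rP rV π₁ π₂ ρ = ∀ B → Downset rP B → ∀ C → Upset rV C → Covered π₁ π₂ ρ B C

Extreme : (Fin 3 → Fin 3) → Fin 3 → Fin 3 → Set
Extreme r x₁ x₂ = ∀ z → (z ≡ x₁ ⊎ toℕ (r x₁) < toℕ (r z)) × (z ≡ x₂ ⊎ toℕ (r z) < toℕ (r x₂))

-- Slots 0, 1 carry the step (a, b), and x₁, x₂ the edge. Keeping the edge works, or moving it
-- by (a b) does and keeps it between x₁ and x₂; and if the moved edge is an edge of u, keeping works.
Certificate : (rP rV : Fin 3 → Fin 3) (x₁ x₂ : Fin 3) → Set
Certificate rP rV x₁ x₂ =
  (Dominated rP rV id τ (σ ∘ τ) ⊎ (Dominated rP rV τ τ (σ ∘ τ′) × Extreme rP x₁ x₂)) ×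
  Dominated rP rV τ τ′ (σ ∘ τ)
  where
  σ  = transpose 0F 1F
  τ  = transpose x₁ x₂
  τ′ = transpose (σ x₁) (σ x₂)

-- The three orders of the slots in which 0 precedes 1, named by the place of slot 2.
kFirst kMiddle kLast : Fin 3 → Fin 3
kFirst 0F = 1F
kFirst 1F = 2F
kFirst 2F = 0F
kMiddle 0F = 0F
kMiddle 1F = 2F
kMiddle 2F = 1F
kLast x = x

Certified : (rP : Fin 3 → Fin 3) (x₁ x₂ : Fin 3) → Set
Certified rP x₁ x₂ = Certificate rP kFirst x₁ x₂ × Certificate rP kMiddle x₁ x₂ × Certificate rP kLast x₁ x₂

pattern-η : ∀ (B : Pattern) → ∀ x → B x ≡ (B 0F ∷ B 1F ∷ B 2F ∷ []) x
pattern-η B 0F = refl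
pattern-η B 1F = refl
pattern-η B 2F = refl

allBool? : {P : Bool → Set} → (∀ b → Dec (P b)) → Dec (∀ b → P b)
allBool? P? with P? true | P? false
... | yes t | yes f = yes λ { true → t ; false → f }
... | no ¬t | _     = no λ all → ¬t (all true)
... | _     | no ¬f = no λ all → ¬f (all false)

allPatterns? : {P : Pattern → Set} → (∀ {B B′} → (∀ x → B x ≡ B′ x) → P B → P B′) →
  (∀ B → Dec (P B)) → Dec (∀ B → P B)
allPatterns? resp P? with allBool? (λ b₀ → allBool? λ b₁ → allBool? λ b₂ → P? (b₀ ∷ b₁ ∷ b₂ ∷ []))
... | yes all = yes λ B → resp (sym ∘ pattern-η B) (all (B 0F) (B 1F) (B 2F))
... | no ¬all = no λ all → ¬all λ b₀ b₁ b₂ → all _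

localRank-cong : ∀ π {B B′ C C′} → (∀ x → B x ≡ B′ x) → (∀ x → C x ≡ C′ x) →
  localRank π B C ≡ localRank π B′ C′
localRank-cong π B≗B′ C≗C′ = sum-cong-≗ λ x → cong₂ (λ b c → 𝟙 (b ∧ c)) (B≗B′ x) (C≗C′ (π x))

Covered-resp : ∀ π₁ π₂ ρ {B B′ C C′} → (∀ x → B x ≡ B′ x) → (∀ x → C x ≡ C′ x) →
  Covered π₁ π₂ ρ B C → Covered π₁ π₂ ρ B′ C′
Covered-resp π₁ π₂ ρ B≗B′ C≗C′ = Sum.map (subst₂ _≤_ (lr π₁) (lr ρ)) (subst₂ _≤_ (lr π₂) (lr ρ))
  where lr = λ π → localRank-cong π B≗B′ C≗C′

Downset? : ∀ r B → Dec (Downset r B)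
Downset? r B = all? λ x → all? λ y → (toℕ (r x) <? toℕ (r y)) →-dec (T? (B y) →-dec T? (B x))

Upset? : ∀ r C → Dec (Upset r C)
Upset? r C = all? λ x → all? λ y → (toℕ (r x) <? toℕ (r y)) →-dec (T? (C x) →-dec T? (C y))

Dominated? : ∀ rP rV π₁ π₂ ρ → Dec (Dominated rP rV π₁ π₂ ρ)
Dominated? rP rV π₁ π₂ ρ =
  allPatterns? respB λ B → Downset? rP B →-dec
  allPatterns? (respC B) λ C → Upset? rV C →-dec
  ((localRank π₁ B C ≤? localRank ρ B C) ⊎-dec (localRank π₂ B C ≤? localRank ρ B C))
  where
  respC : ∀ B {C C′} → (∀ x → C x ≡ C′ x) →
    (Upset rV C → Covered π₁ π₂ ρ B C) → Upset rV C′ → Covered π₁ π₂ ρ B C′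
  respC B {C} {C′} C≗C′ cov up′ = Covered-resp π₁ π₂ ρ {B} {B} {C} {C′} (λ _ → refl) C≗C′
    (cov λ x y r< c → subst T (sym (C≗C′ y)) (up′ x y r< (subst T (C≗C′ x) c)))
  respB : ∀ {B B′} → (∀ x → B x ≡ B′ x) →
    (Downset rP B → ∀ C → Upset rV C → Covered π₁ π₂ ρ B C) →
    Downset rP B′ → ∀ C → Upset rV C → Covered π₁ π₂ ρ B′ C
  respB {B} {B′} B≗B′ cov down′ C up = Covered-resp π₁ π₂ ρ {B} {B′} {C} {C} B≗B′ (λ _ → refl)
    (cov (λ x y r< b → subst T (sym (B≗B′ x)) (down′ x y r< (subst T (B≗B′ y) b))) C up)

Extreme? : ∀ r x₁ x₂ → Dec (Extreme r x₁ x₂)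
Extreme? r x₁ x₂ = all? λ z →
  ((z ≟ᶠ x₁) ⊎-dec (toℕ (r x₁) <? toℕ (r z))) ×-dec ((z ≟ᶠ x₂) ⊎-dec (toℕ (r z) <? toℕ (r x₂)))

Certificate? : ∀ rP rV x₁ x₂ → Dec (Certificate rP rV x₁ x₂)
Certificate? rP rV x₁ x₂ =
  (Dominated? rP rV id τ (σ ∘ τ) ⊎-dec (Dominated? rP rV τ τ (σ ∘ τ′) ×-dec Extreme? rP x₁ x₂)) ×-dec
  Dominated? rP rV τ τ′ (σ ∘ τ)
  where
  σ  = transpose 0F 1F
  τ  = transpose x₁ x₂
  τ′ = transpose (σ x₁) (σ x₂)

Certified? : ∀ rP x₁ x₂ → Dec (Certified rP x₁ x₂)
Certified? rP x₁ x₂ =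
  Certificate? rP kFirst x₁ x₂ ×-dec Certificate? rP kMiddle x₁ x₂ ×-dec Certificate? rP kLast x₁ x₂

-- The six ways an edge can share exactly one endpoint with the step (a, b), the third position
-- being k; each certificate is found by evaluation.
edge-ak-kMiddle : Certified kMiddle 0F 2F
edge-ak-kMiddle = from-yes (Certified? kMiddle 0F 2F)

edge-ak-kLast : Certified kLast 0F 2F
edge-ak-kLast = from-yes (Certified? kLast 0F 2F)

edge-bk-kLast : Certified kLast 1F 2F
edge-bk-kLast = from-yes (Certified? kLast 1F 2F)

edge-ka-kFirst : Certified kFirst 2F 0F
edge-ka-kFirst = from-yes (Certified? kFirst 2F 0F)

edge-kb-kFirst : Certified kFirst 2F 1F
edge-kb-kFirst = from-yes (Certified? kFirst 2F 1F)

edge-kb-kMiddle : Certified kMiddle 2F 1F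
edge-kb-kMiddle = from-yes (Certified? kMiddle 2F 1F)

Sorted : (Fin 3 → Fin 3) → (Fin 3 → ℕ) → Set
Sorted r f = ∀ x y → toℕ (r x) < toℕ (r y) → f x < f y

kFirst-sorted : ∀ {f} → f 2F < f 0F → f 0F < f 1F → Sorted kFirst f
kFirst-sorted k<a a<b 0F 1F _ = a<b
kFirst-sorted k<a a<b 2F 0F _ = k<a
kFirst-sorted k<a a<b 2F 1F _ = <-trans k<a a<b
kFirst-sorted k<a a<b 0F 0F (s≤s ())
kFirst-sorted k<a a<b 0F 2F ()
kFirst-sorted k<a a<b 1F 0F (s≤s ())
kFirst-sorted k<a a<b 1F 1F (s≤s (s≤s ()))
kFirst-sorted k<a a<b 1F 2F ()
kFirst-sorted k<a a<b 2F 2F ()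

kMiddle-sorted : ∀ {f} → f 0F < f 2F → f 2F < f 1F → Sorted kMiddle f
kMiddle-sorted a<k k<b 0F 2F _ = a<k
kMiddle-sorted a<k k<b 2F 1F _ = k<b
kMiddle-sorted a<k k<b 0F 1F _ = <-trans a<k k<b
kMiddle-sorted a<k k<b 0F 0F ()
kMiddle-sorted a<k k<b 1F 0F ()
kMiddle-sorted a<k k<b 1F 1F (s≤s (s≤s ()))
kMiddle-sorted a<k k<b 1F 2F (s≤s ())
kMiddle-sorted a<k k<b 2F 0F ()
kMiddle-sorted a<k k<b 2F 2F (s≤s ())

kLast-sorted : ∀ {f} → f 0F < f 1F → f 1F < f 2F → Sorted kLast f
kLast-sorted a<b b<k 0F 1F _ = a<b
kLast-sorted a<b b<k 1F 2F _ = b<k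
kLast-sorted a<b b<k 0F 2F _ = <-trans a<b b<k
kLast-sorted a<b b<k 0F 0F ()
kLast-sorted a<b b<k 1F 0F ()
kLast-sorted a<b b<k 1F 1F (s≤s ())
kLast-sorted a<b b<k 2F 0F ()
kLast-sorted a<b b<k 2F 1F (s≤s ())
kLast-sorted a<b b<k 2F 2F (s≤s (s≤s ()))

module ThreePositions {n} (u : Word n) (pos : Fin 3 → Fin n) (pos-injective : Injective _≡_ _≡_ pos) where

  record Realizes (π : Fin 3 → Fin 3) (y : Word n) : Set where
    constructor realizes
    field
      off-image : ∀ s → Avoids pos s → lookup y s ≡ lookup u s
      on-image  : ∀ x → lookup y (pos x) ≡ lookup u (pos (π x))

  realizes-id : Realizes id u
  realizes-id = realizes (λ _ _ → refl) (λ _ → refl)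

  transpose-pos : ∀ x₁ x₂ z → transpose (pos x₁) (pos x₂) (pos z) ≡ pos (transpose x₁ x₂ z)
  transpose-pos x₁ x₂ z = by-cases (z ≟ᶠ x₁) (z ≟ᶠ x₂)
    where
    by-cases : Dec (z ≡ x₁) → Dec (z ≡ x₂) → transpose (pos x₁) (pos x₂) (pos z) ≡ pos (transpose x₁ x₂ z)
    by-cases (yes refl) _ = trans (transpose-matchˡ (pos z) (pos x₂)) (cong pos (sym (transpose-matchˡ z x₂)))
    by-cases (no z≢x₁) (yes refl) = trans (transpose-matchʳ (pos x₁) (pos z)) (cong pos (sym (transpose-matchʳ x₁ z)))
    by-cases (no z≢x₁) (no z≢x₂) =
      trans (transpose-other (pos x₁) (pos x₂) (z≢x₁ ∘ pos-injective) (z≢x₂ ∘ pos-injective))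
            (cong pos (sym (transpose-other x₁ x₂ z≢x₁ z≢x₂)))

  realizes-swap : ∀ {π y} → Realizes π y → ∀ x₁ x₂ → Realizes (π ∘ transpose x₁ x₂) (swap y (pos x₁) (pos x₂))
  realizes-swap {π} {y} (realizes off on) x₁ x₂ = realizes off′ on′
    where
    off′ : ∀ s → Avoids pos s → lookup (swap y (pos x₁) (pos x₂)) s ≡ lookup u s
    off′ s avoids = trans (lookup-swap y _ _ s)
      (trans (cong (lookup y) (transpose-other _ _ (avoids x₁ ∘ sym) (avoids x₂ ∘ sym))) (off s avoids))
    on′ : ∀ z → lookup (swap y (pos x₁) (pos x₂)) (pos z) ≡ lookup u (pos (π (transpose x₁ x₂ z)))
    on′ z = trans (lookup-swap y _ _ (pos z)) (trans (cong (lookup y) (transpose-pos x₁ x₂ z)) (on _))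

  below : Fin n → Pattern
  below p x = toℕ (pos x) ≤ᵇ toℕ p

  large : ℕ → Pattern
  large k x = k ≤ᵇ val u (pos x)

  rank-realizes : ∀ {π y} → Realizes π y → ∀ p k →
    rank y p k ≡ localRank π (below p) (large k) + sum (outside pos (rankTerm u p k))
  rank-realizes {π} {y} (realizes off on) p k = begin
    rank y p k                                     ≡⟨ sum-split-image pos pos-injective (rankTerm y p k) ⟩
    sum (rankTerm y p k ∘ pos) + sum (outside pos (rankTerm y p k))
      ≡⟨ cong₂ _+_ (sum-cong-≗ on-image) (sum-cong-≗ (outside-pointwise _≡_ refl pos off-image)) ⟩
    localRank π (below p) (large k) + sum (outside pos (rankTerm u p k)) ∎
    where
    open ≡-Reasoning
    on-image : ∀ x → rankTerm y p k (pos x) ≡ 𝟙 (below p x ∧ large k (π x))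
    on-image x = cong (λ z → 𝟙 (below p x ∧ (k ≤ᵇ toℕ z))) (on x)
    off-image : ∀ s → Avoids pos s → rankTerm y p k s ≡ rankTerm u p k s
    off-image s avoids = cong (λ z → 𝟙 ((toℕ s ≤ᵇ toℕ p) ∧ (k ≤ᵇ toℕ z))) (off s avoids)

  -- w ⊑ y₁ and w ⊑ y₂ bound rank w by the smaller of their ranks, and Dominated bounds that by rank y₃.
  ⊑-dominated : ∀ {rP rV π₁ π₂ ρ y₁ y₂ y₃} {w : Word n} →
    Sorted rP (toℕ ∘ pos) → Sorted rV (val u ∘ pos) → Dominated rP rV π₁ π₂ ρ →
    Realizes π₁ y₁ → Realizes π₂ y₂ → Realizes ρ y₃ → w ⊑ y₁ → w ⊑ y₂ → w ⊑ y₃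
  ⊑-dominated {rP} {rV} {π₁} {π₂} {ρ} {y₁} {y₂} {y₃} {w} sortedP sortedV dom r₁ r₂ r₃ w⊑y₁ w⊑y₂ =
    rank-dominated λ p k →
      Sum.[ via p k r₁ (rank-≤ w⊑y₁ p k) , via p k r₂ (rank-≤ w⊑y₂ p k) ]
        (dom (below p) (λ x y r< → ≤ᵇ-antitone p (sortedP x y r<))
             (large k) (λ x y r< → ≤ᵇ-mono k (<⇒≤ (sortedV x y r<))))
    where
    via : ∀ p k {π y} → Realizes π y → rank w p k ≤ rank y p k →
      localRank π (below p) (large k) ≤ localRank ρ (below p) (large k) → rank w p k ≤ rank y₃ p k
    via p k r w≤y local≤ = ≤-trans w≤y
      (subst₂ _≤_ (sym (rank-realizes r p k)) (sym (rank-realizes r₃ p k)) (+-monoˡ-≤ _ local≤))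

-- Moving an edge along an upward step

sortPair : ∀ {n} → Fin n → Fin n → Fin n × Fin n
sortPair p q = if toℕ p <ᵇ toℕ q then (p , q) else (q , p)

sortPair-cases : ∀ {n} (p q : Fin n) → sortPair p q ≡ (p , q) ⊎ sortPair p q ≡ (q , p)
sortPair-cases p q with toℕ p <ᵇ toℕ q
... | true  = inj₁ refl
... | false = inj₂ refl

sortPair-< : ∀ {n} {p q : Fin n} → p ≢ q → toℕ (proj₁ (sortPair p q)) < toℕ (proj₂ (sortPair p q))
sortPair-< {p = p} {q} p≢q with toℕ p <ᵇ toℕ q in p<ᵇq
... | true  = <ᵇ⇒< _ _ (from T-≡ p<ᵇq)
... | false with <-cmp (toℕ p) (toℕ q)
...   | tri< p<q _ _ = ⊥-elim (subst T p<ᵇq (<⇒<ᵇ p<q))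
...   | tri≈ _ p≡q _ = ⊥-elim (p≢q (toℕ-injective p≡q))
...   | tri> _ _ q<p = q<p

sortPair-all : ∀ {n} (P : Fin n → Set) {p q} → P p → P q → P (proj₁ (sortPair p q)) × P (proj₂ (sortPair p q))
sortPair-all P {p} {q} Pp Pq with toℕ p <ᵇ toℕ q
... | true  = Pp , Pq
... | false = Pq , Pp

sortPair-injective : ∀ {n} {p q p′ q′ : Fin n} → sortPair p q ≡ sortPair p′ q′ →
  (p ≡ p′ × q ≡ q′) ⊎ (p ≡ q′ × q ≡ p′)
sortPair-injective {p = p} {q} {p′} {q′} e with sortPair-cases p q | sortPair-cases p′ q′
... | inj₁ e₁ | inj₁ e₂ = inj₁ (,-injective (trans (sym e₁) (trans e e₂)))
... | inj₁ e₁ | inj₂ e₂ = inj₂ (,-injective (trans (sym e₁) (trans e e₂)))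
... | inj₂ e₁ | inj₁ e₂ = inj₂ (Data.Product.swap (,-injective (trans (sym e₁) (trans e e₂))))
... | inj₂ e₁ | inj₂ e₂ = inj₁ (Data.Product.swap (,-injective (trans (sym e₁) (trans e e₂))))

swap₂ : ∀ {n} → Word n → Fin n × Fin n → Word n
swap₂ y e = swap y (proj₁ e) (proj₂ e)

swap₂-sortPair : ∀ {n} (y : Word n) p q → swap₂ y (sortPair p q) ≡ swap y p q
swap₂-sortPair y p q with toℕ p <ᵇ toℕ q
... | true  = refl
... | false = swap-comm y q p

IsHPair : ∀ {n} → (Fin n → Fin n) → Fin n × Fin n → Set
IsHPair h e = (toℕ (proj₁ e) < toℕ (proj₂ e)) × (toℕ (proj₂ e) ≤ toℕ (h (proj₁ e)))

triple-injective : ∀ {n} {a b k : Fin n} → a ≢ b → a ≢ k → b ≢ k → Injective _≡_ _≡_ (a ∷ b ∷ k ∷ [])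
triple-injective a≢b a≢k b≢k {0F} {0F} _ = refl
triple-injective a≢b a≢k b≢k {0F} {1F} e = ⊥-elim (a≢b e)
triple-injective a≢b a≢k b≢k {0F} {2F} e = ⊥-elim (a≢k e)
triple-injective a≢b a≢k b≢k {1F} {0F} e = ⊥-elim (a≢b (sym e))
triple-injective a≢b a≢k b≢k {1F} {1F} _ = refl
triple-injective a≢b a≢k b≢k {1F} {2F} e = ⊥-elim (b≢k e)
triple-injective a≢b a≢k b≢k {2F} {0F} e = ⊥-elim (a≢k (sym e))
triple-injective a≢b a≢k b≢k {2F} {1F} e = ⊥-elim (b≢k (sym e))
triple-injective a≢b a≢k b≢k {2F} {2F} _ = refl

module EdgeTransfer {n} (h : Fin n → Fin n) (h-mono : ∀ i j → toℕ i ≤ toℕ j → toℕ (h i) ≤ toℕ (h j))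
  (w u : Word n) (u-perm : IsPerm u) (w⊑u : w ⊑ u)
  {a b : Fin n} (a<b : toℕ a < toℕ b) (uₐ<u_b : val u a < val u b) where

  v : Word n
  v = swap u a b

  moved : Fin n → Fin n → Fin n × Fin n
  moved i j = sortPair (transpose a b i) (transpose a b j)

  record Transfer (i j : Fin n) : Set where
    field
      kept-or-moved      : w ⊑ swap v i j ⊎ (IsHPair h (moved i j) × w ⊑ swap₂ v (moved i j))
      kept-if-moved-back : w ⊑ swap₂ u (moved i j) → w ⊑ swap v i j

  private
    a≢b = <⇒≢ᶠ a<b

  module _ {k : Fin n} (a≢k : a ≢ k) (b≢k : b ≢ k) where

    private
      pos : Fin 3 → Fin n
      pos = a ∷ b ∷ k ∷ []

    open ThreePositions u pos (triple-injective a≢b a≢k b≢k)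

    moved-pos : ∀ y x₁ x₂ →
      swap₂ y (moved (pos x₁) (pos x₂)) ≡ swap y (pos (transpose 0F 1F x₁)) (pos (transpose 0F 1F x₂))
    moved-pos y x₁ x₂ = trans (swap₂-sortPair y _ _) (cong₂ (swap y) (transpose-pos 0F 1F x₁) (transpose-pos 0F 1F x₂))

    moved-IsHPair : ∀ {rP x₁ x₂} → Sorted rP (toℕ ∘ pos) → Extreme rP x₁ x₂ →
      toℕ (pos x₁) < toℕ (pos x₂) → toℕ (pos x₂) ≤ toℕ (h (pos x₁)) → IsHPair h (moved (pos x₁) (pos x₂))
    moved-IsHPair {rP} {x₁} {x₂} sortedP extreme x₁<x₂ x₂≤h = first<second , second≤h
      where
      Within : Fin n → Set
      Within s = toℕ (pos x₁) ≤ toℕ s × toℕ s ≤ toℕ (pos x₂)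
      within : ∀ z → Within (pos (transpose 0F 1F z))
      within z = Sum.[ (λ { refl → ≤-refl }) , <⇒≤ ∘ sortedP x₁ z′ ] (proj₁ (extreme z′)) ,
                 Sum.[ (λ { refl → ≤-refl }) , <⇒≤ ∘ sortedP z′ x₂ ] (proj₂ (extreme z′))
        where z′ = transpose 0F 1F z
      e = moved (pos x₁) (pos x₂)
      bounds : Within (proj₁ e) × Within (proj₂ e)
      bounds = sortPair-all Within (subst Within (sym (transpose-pos 0F 1F x₁)) (within x₁))
                                   (subst Within (sym (transpose-pos 0F 1F x₂)) (within x₂))
      first<second : toℕ (proj₁ e) < toℕ (proj₂ e)
      first<second = sortPair-< λ same → <⇒≢ᶠ x₁<x₂ (cong pos (transpose-injective 0F 1F {x₁} {x₂}
        (triple-injective a≢b a≢k b≢k (trans (sym (transpose-pos 0F 1F x₁)) (trans same (transpose-pos 0F 1F x₂))))))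
      second≤h : toℕ (proj₂ e) ≤ toℕ (h (proj₁ e))
      second≤h = ≤-trans (proj₂ (proj₂ bounds)) (≤-trans x₂≤h (h-mono _ _ (proj₁ (proj₁ bounds))))

    transfer-certified : ∀ {rP rV x₁ x₂} → Sorted rP (toℕ ∘ pos) → Sorted rV (val u ∘ pos) →
      Certificate rP rV x₁ x₂ → toℕ (pos x₁) < toℕ (pos x₂) → toℕ (pos x₂) ≤ toℕ (h (pos x₁)) →
      w ⊑ swap u (pos x₁) (pos x₂) → Transfer (pos x₁) (pos x₂)
    transfer-certified {rP} {rV} {x₁} {x₂} sortedP sortedV (keep-or-move , back) x₁<x₂ x₂≤h w⊑ue = record
      { kept-or-moved = Sum.map
          (λ keep → ⊑-dominated {rP} {rV} sortedP sortedV keep realizes-id r-ue r-ve w⊑u w⊑ue)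
          (λ { (move , extreme) → moved-IsHPair sortedP extreme x₁<x₂ x₂≤h ,
               subst (w ⊑_) (sym (moved-pos v x₁ x₂))
                 (⊑-dominated {rP} {rV} sortedP sortedV move r-ue r-ue r-vte w⊑ue w⊑ue) })
          keep-or-move
      ; kept-if-moved-back = λ w⊑ute →
          ⊑-dominated {rP} {rV} sortedP sortedV back r-ue r-ute r-ve w⊑ue (subst (w ⊑_) (moved-pos u x₁ x₂) w⊑ute)
      }
      where
      y₁ = transpose 0F 1F x₁
      y₂ = transpose 0F 1F x₂
      r-ue  = realizes-swap realizes-id x₁ x₂
      r-v   = realizes-swap realizes-id 0F 1F
      r-ve  = realizes-swap r-v x₁ x₂
      r-ute = realizes-swap realizes-id y₁ y₂
      r-vte = realizes-swap r-v y₁ y₂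

    transfer-three : ∀ {rP x₁ x₂} → Sorted rP (toℕ ∘ pos) → Certified rP x₁ x₂ →
      toℕ (pos x₁) < toℕ (pos x₂) → toℕ (pos x₂) ≤ toℕ (h (pos x₁)) →
      w ⊑ swap u (pos x₁) (pos x₂) → Transfer (pos x₁) (pos x₂)
    transfer-three {rP} sortedP (c-first , c-middle , c-last)
      with <-cmp (val u k) (val u a) | <-cmp (val u k) (val u b)
    ... | tri≈ _ uₖ≡uₐ _ | _ = ⊥-elim (a≢k (sym (val-injective u u-perm uₖ≡uₐ)))
    ... | _ | tri≈ _ uₖ≡u_b _ = ⊥-elim (b≢k (sym (val-injective u u-perm uₖ≡u_b)))
    ... | tri< uₖ<uₐ _ _ | _ =
      transfer-certified {rP} {kFirst} sortedP (kFirst-sorted uₖ<uₐ uₐ<u_b) c-first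
    ... | tri> _ _ uₐ<uₖ | tri< uₖ<u_b _ _ =
      transfer-certified {rP} {kMiddle} sortedP (kMiddle-sorted uₐ<uₖ uₖ<u_b) c-middle
    ... | tri> _ _ uₐ<uₖ | tri> _ _ u_b<uₖ =
      transfer-certified {rP} {kLast} sortedP (kLast-sorted uₐ<u_b u_b<uₖ) c-last

  transfer : ∀ i j → toℕ i < toℕ j → toℕ j ≤ toℕ (h i) → w ⊑ swap u i j → Transfer i j
  transfer i j i<j j≤h w⊑ue = by-cases (i ≟ᶠ a) (i ≟ᶠ b) (j ≟ᶠ a) (j ≟ᶠ b)
    where
    by-cases : Dec (i ≡ a) → Dec (i ≡ b) → Dec (j ≡ a) → Dec (j ≡ b) → Transfer i j
    by-cases (yes refl) _ _ (yes refl) = record { kept-or-moved = inj₁ w⊑u′ ; kept-if-moved-back = λ _ → w⊑u′ }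
      where
      w⊑u′ : w ⊑ swap v i j
      w⊑u′ = subst (w ⊑_) (sym (swap-involutive u i j)) w⊑u
    by-cases (yes refl) _ _ (no j≢b) with <-cmp (toℕ j) (toℕ b)
    ... | tri< j<b _ _ =
      transfer-three (<⇒≢ᶠ i<j) (j≢b ∘ sym) {kMiddle} (kMiddle-sorted i<j j<b) edge-ak-kMiddle i<j j≤h w⊑ue
    ... | tri≈ _ j≡b _ = ⊥-elim (j≢b (toℕ-injective j≡b))
    ... | tri> _ _ b<j =
      transfer-three (<⇒≢ᶠ i<j) (<⇒≢ᶠ b<j) {kLast} (kLast-sorted a<b b<j) edge-ak-kLast i<j j≤h w⊑ue
    by-cases (no i≢a) (yes refl) _ _ =
      transfer-three (<⇒≢ᶠ (<-trans a<b i<j)) (<⇒≢ᶠ i<j) {kLast} (kLast-sorted a<b i<j) edge-bk-kLast i<j j≤h w⊑ue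
    by-cases (no i≢a) (no i≢b) (yes refl) _ =
      transfer-three (>⇒≢ᶠ i<j) (>⇒≢ᶠ (<-trans i<j a<b)) {kFirst} (kFirst-sorted i<j a<b) edge-ka-kFirst i<j j≤h w⊑ue
    by-cases (no i≢a) (no i≢b) (no j≢a) (yes refl) with <-cmp (toℕ i) (toℕ a)
    ... | tri< i<a _ _ =
      transfer-three (i≢a ∘ sym) (i≢b ∘ sym) {kFirst} (kFirst-sorted i<a a<b) edge-kb-kFirst i<j j≤h w⊑ue
    ... | tri≈ _ i≡a _ = ⊥-elim (i≢a (toℕ-injective i≡a))
    ... | tri> _ _ a<i =
      transfer-three (i≢a ∘ sym) (i≢b ∘ sym) {kMiddle} (kMiddle-sorted a<i i<j) edge-kb-kMiddle i<j j≤h w⊑ue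
    by-cases (no i≢a) (no i≢b) (no j≢a) (no j≢b) =
      record { kept-or-moved = inj₁ w⊑vij ; kept-if-moved-back = λ _ → w⊑vij }
      where
      ue = swap u i j
      swaps-commute : swap v i j ≡ swap ue a b
      swaps-commute = word-ext λ s →
        trans (lookup-swap v i j s) (trans (lookup-swap u a b (transpose i j s))
          (trans (cong (lookup u) (transpose-commute (i≢a ∘ sym) (j≢a ∘ sym) (i≢b ∘ sym) (j≢b ∘ sym) s))
          (trans (sym (lookup-swap u i j (transpose a b s))) (sym (lookup-swap ue a b s)))))
      ueₐ<ue_b : val ue a < val ue b
      ueₐ<ue_b rewrite val-swap-other u i j (i≢a ∘ sym) (j≢a ∘ sym) | val-swap-other u i j (i≢b ∘ sym) (j≢b ∘ sym) = uₐ<u_b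
      w⊑vij : w ⊑ swap v i j
      w⊑vij = subst (w ⊑_) (sym swaps-commute) (⊑-trans w⊑ue (⊑-swap ue a<b ueₐ<ue_b))

module EdgeInjection {n} (h : Fin n → Fin n) (hess : IsHessenberg h) (w : Word n) (w-perm : IsPerm w)
  (u : Word n) (w≼u : w ≼ u) {a b : Fin n} (a<b : toℕ a < toℕ b) (inv< : inv u < inv (swap u a b)) where

  private
    u-perm : IsPerm u
    u-perm = IsPerm-≼ w-perm w≼u

  open EdgeTransfer h (proj₁ hess) w u u-perm (≼⇒⊑ w-perm w≼u) a<b (inv-swap-<⇒val< u a<b u-perm inv<)

  private
    v-swap-perm : ∀ i j → IsPerm (swap v i j)
    v-swap-perm i j = IsPerm-swap v i j (IsPerm-swap u a b u-perm)

    transfer-edge : (e : Edge w h u) → Transfer (proj₁ (proj₁ e)) (proj₂ (proj₁ e))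
    transfer-edge ((i , j) , i<j , j≤h , w≼ue) = transfer i j i<j j≤h (≼⇒⊑ w-perm w≼ue)

    Kept : Edge w h u → Set
    Kept ((i , j) , _) = w ≼ swap v i j

  image : (e : Edge w h u) → Dec (Kept e) → Edge w h v
  image ((i , j) , i<j , j≤h , _) (yes w≼ve) = (i , j) , i<j , j≤h , w≼ve
  image e@((i , j) , _) (no w⋠ve) with Transfer.kept-or-moved (transfer-edge e)
  ... | inj₁ w⊑ve = ⊥-elim (w⋠ve (⊑⇒≼ w-perm (v-swap-perm i j) w⊑ve))
  ... | inj₂ ((i′<j′ , j′≤h) , w⊑vte) = moved i j , i′<j′ , j′≤h , ⊑⇒≼ w-perm (v-swap-perm _ _) w⊑vte

  image-kept : ∀ e k → proj₁ (image e (yes k)) ≡ proj₁ e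
  image-kept ((i , j) , _) _ = refl

  image-moved : ∀ e ¬k → proj₁ (image e (no ¬k)) ≡ moved (proj₁ (proj₁ e)) (proj₂ (proj₁ e))
  image-moved e@((i , j) , _) ¬k with Transfer.kept-or-moved (transfer-edge e)
  ... | inj₁ w⊑ve = ⊥-elim (¬k (⊑⇒≼ w-perm (v-swap-perm i j) w⊑ve))
  ... | inj₂ _ = refl

  -- A kept edge is never the image of a moved one: moving back would have kept it.
  kept≢moved : ∀ (e₁ e₂ : Edge w h u) → ¬ Kept e₂ → proj₁ e₁ ≢ moved (proj₁ (proj₁ e₂)) (proj₂ (proj₁ e₂))
  kept≢moved ((i₁ , j₁) , _ , _ , w≼ue₁) e₂@((i₂ , j₂) , _) ¬k e =
    ¬k (⊑⇒≼ w-perm (v-swap-perm i₂ j₂) (Transfer.kept-if-moved-back (transfer-edge e₂)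
      (≼⇒⊑ w-perm (subst (λ p → w ≼ swap₂ u p) e w≼ue₁))))

  moved-injective : ∀ (e₁ e₂ : Edge w h u) →
    moved (proj₁ (proj₁ e₁)) (proj₂ (proj₁ e₁)) ≡ moved (proj₁ (proj₁ e₂)) (proj₂ (proj₁ e₂)) → proj₁ e₁ ≡ proj₁ e₂
  moved-injective ((i₁ , j₁) , i₁<j₁ , _) ((i₂ , j₂) , i₂<j₂ , _) e with sortPair-injective e
  ... | inj₁ (i₁≡i₂ , j₁≡j₂) = cong₂ _,_ (transpose-injective a b i₁≡i₂) (transpose-injective a b j₁≡j₂)
  ... | inj₂ (i₁≡j₂ , j₁≡i₂) = ⊥-elim (<-asym i₁<j₁
      (subst₂ (λ p q → toℕ p < toℕ q) (sym (transpose-injective a b j₁≡i₂)) (sym (transpose-injective a b i₁≡j₂)) i₂<j₂))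

  image-injective : ∀ e₁ e₂ (k₁ : Dec (Kept e₁)) (k₂ : Dec (Kept e₂)) →
    proj₁ (image e₁ k₁) ≡ proj₁ (image e₂ k₂) → proj₁ e₁ ≡ proj₁ e₂
  image-injective e₁ e₂ (yes k₁) (yes k₂) e = trans (sym (image-kept e₁ k₁)) (trans e (image-kept e₂ k₂))
  image-injective e₁ e₂ (yes k₁) (no ¬k₂) e =
    ⊥-elim (kept≢moved e₁ e₂ ¬k₂ (trans (sym (image-kept e₁ k₁)) (trans e (image-moved e₂ ¬k₂))))
  image-injective e₁ e₂ (no ¬k₁) (yes k₂) e =
    ⊥-elim (kept≢moved e₂ e₁ ¬k₁ (trans (sym (image-kept e₂ k₂)) (trans (sym e) (image-moved e₁ ¬k₁))))
  image-injective e₁ e₂ (no ¬k₁) (no ¬k₂) e =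
    moved-injective e₁ e₂ (trans (sym (image-moved e₁ ¬k₁)) (trans e (image-moved e₂ ¬k₂)))

  kept? : ∀ e → Dec (Kept e)
  kept? ((i , j) , _) = ≼-dec w-perm (v-swap-perm i j)

  edge-injection : CardLe w h u v
  edge-injection = (λ e → image e (kept? e)) , (λ e₁ e₂ → image-injective e₁ e₂ (kept? e₁) (kept? e₂))

CardLe-refl : ∀ {n} {w : Word n} {h} {x : Word n} → CardLe w h x x
CardLe-refl = id , λ _ _ → id

CardLe-trans : ∀ {n} {w : Word n} {h} {x y z : Word n} → CardLe w h x y → CardLe w h y z → CardLe w h x z
CardLe-trans (f , f-inj) (g , g-inj) = g ∘ f , λ a b e → f-inj a b (g-inj (f a) (f b) e)

CardLe-≼[h] : ∀ {n} (h : Fin n → Fin n) → IsHessenberg h → (w : Word n) → IsPerm w →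
  ∀ {u v} → w ≼ u → u ≼[ h ] v → CardLe w h u v
CardLe-≼[h] h hess w w-perm {u} w≼u ε = CardLe-refl {w = w} {h} {u}
CardLe-≼[h] h hess w w-perm {u} {v} w≼u ((a , b , a<b , _ , refl , inv<) ◅ rest) =
  CardLe-trans {w = w} {h} {u} {swap u a b} {v} (EdgeInjection.edge-injection h hess w w-perm u w≼u a<b inv<)
    (CardLe-≼[h] h hess w w-perm (w≼u ◅◅ ((a , b , a<b , refl , inv<) ◅ ε)) rest)

-- A generator lies h-below w₀

module GeneratorChain {n} (h : Fin n → Fin n) (hess : IsHessenberg h) where

  IsCut : Fin n → Set
  IsCut i = toℕ (h i) ≡ toℕ i

  CutsClosed : Word n → Set
  CutsClosed u = ∀ i p q → IsCut i → toℕ p ≤ toℕ i → val u q ≡ suc (val u p) → toℕ q ≤ toℕ i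

  DescendingPrefix : Word n → ℕ → Set
  DescendingPrefix u t = ∀ s → toℕ s < t → val u s ≡ n ∸ suc (toℕ s)

  generator⇒CutsClosed : ∀ {w} → IsGenerator h w → CutsClosed w
  generator⇒CutsClosed gen i p q cut p≤i wq≡1+wp =
    ≤-trans (gen p q wq≡1+wp) (≤-trans (proj₁ hess p i p≤i) (≤-reflexive cut))

  value-left-of-cut : ∀ u → IsPerm u → CutsClosed u → ∀ {i} → IsCut i → ∀ d p {c} →
    toℕ p ≤ toℕ i → val u p + d ≡ c → c < n → ∃[ q ] (val u q ≡ c × toℕ q ≤ toℕ i)
  value-left-of-cut u u-perm closed cut zero p p≤i uₚ+0≡c c<n = p , trans (sym (+-identityʳ _)) uₚ+0≡c , p≤i
  value-left-of-cut u u-perm closed {i} cut (suc d) p {c} p≤i uₚ+1+d≡c c<n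
    with IsPerm⇒surjective u u-perm (fromℕ< 1+uₚ<n)
    where
    1+uₚ<n : suc (val u p) < n
    1+uₚ<n = ≤-<-trans (≤-trans (s≤s (m≤m+n (val u p) d)) (≤-reflexive (trans (sym (+-suc (val u p) d)) uₚ+1+d≡c))) c<n
  ... | q , uq≡1+uₚ = value-left-of-cut u u-perm closed cut d q (closed i p q cut p≤i uq≡1+uₚ′) uq+d≡c c<n
    where
    uq≡1+uₚ′ : val u q ≡ suc (val u p)
    uq≡1+uₚ′ = trans (cong toℕ uq≡1+uₚ) (toℕ-fromℕ< _)
    uq+d≡c : val u q + d ≡ c
    uq+d≡c = trans (cong (_+ d) uq≡1+uₚ′) (trans (sym (+-suc (val u p) d)) uₚ+1+d≡c)

  private
    ∸-involutive : ∀ {v} → v < n → n ∸ suc (n ∸ suc v) ≡ v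
    ∸-involutive {v} (s≤s v≤n′) = m∸[m∸n]≡n v≤n′

    ∸-suc-< : ∀ {t} → t < n → n ∸ suc t < n
    ∸-suc-< {t} (s≤s t≤n′) = s≤s (m∸n≤m _ t)

  prefix-bound : ∀ u → IsPerm u → ∀ t → DescendingPrefix u t → ∀ x → t ≤ toℕ x → val u x ≤ n ∸ suc t
  prefix-bound u u-perm t prefix x t≤x = ≮⇒≥ too-large
    where
    uₓ<n : val u x < n
    uₓ<n = toℕ<n (lookup u x)
    -- a value above n-1-t already occurs in the prefix, at position n-1-u(x)
    too-large : n ∸ suc t < val u x → ⊥
    too-large n∸1+t<uₓ = <⇒≱ (subst (_< t) s≡x s<t) t≤x
      where
      s : Fin n
      s = fromℕ< (∸-suc-< uₓ<n)
      s<t : toℕ s < t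
      s<t = subst (_< t) (sym (toℕ-fromℕ< _))
        (≰⇒> λ t≤ → <⇒≱ n∸1+t<uₓ (subst (_≤ n ∸ suc t) (∸-involutive uₓ<n) (∸-monoʳ-≤ n (s≤s t≤))))
      s≡x : toℕ s ≡ toℕ x
      s≡x = cong toℕ (val-injective u u-perm
        (trans (prefix s s<t) (trans (cong (λ z → n ∸ suc z) (toℕ-fromℕ< _)) (∸-involutive uₓ<n))))

  adjacent-transpose-side : ∀ {m′ m i : Fin n} → toℕ m ≡ suc (toℕ m′) → toℕ i ≢ toℕ m′ → ∀ x →
    (toℕ x ≤ toℕ i → toℕ (transpose m′ m x) ≤ toℕ i) × (toℕ (transpose m′ m x) ≤ toℕ i → toℕ x ≤ toℕ i)
  adjacent-transpose-side {m′} {m} {i} m≡1+m′ i≢m′ x = by-cases (x ≟ᶠ m′) (x ≟ᶠ m)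
    where
    up : toℕ m′ ≤ toℕ i → toℕ m ≤ toℕ i
    up m′≤i = subst (_≤ toℕ i) (sym m≡1+m′) (≤∧≢⇒< m′≤i (i≢m′ ∘ sym))
    down : toℕ m ≤ toℕ i → toℕ m′ ≤ toℕ i
    down m≤i = ≤-trans (n≤1+n _) (subst (_≤ toℕ i) m≡1+m′ m≤i)
    by-cases : Dec (x ≡ m′) → Dec (x ≡ m) →
      (toℕ x ≤ toℕ i → toℕ (transpose m′ m x) ≤ toℕ i) × (toℕ (transpose m′ m x) ≤ toℕ i → toℕ x ≤ toℕ i)
    by-cases (yes refl) _ rewrite transpose-matchˡ x m = up , down
    by-cases (no x≢m′) (yes refl) rewrite transpose-matchʳ m′ x = down , up
    by-cases (no x≢m′) (no x≢m) rewrite transpose-other m′ m x≢m′ x≢m = id , id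

  record Reachable (u : Word n) (t : ℕ) : Set where
    field
      target  : Word n
      chain   : u ≼[ h ] target
      perm    : IsPerm target
      closed  : CutsClosed target
      prefix  : DescendingPrefix target t

  module Placing (t : ℕ) (t<n : t < n) where

    c : ℕ
    c = n ∸ suc t

    module Swap (u : Word n) (u-perm : IsPerm u) (closed : CutsClosed u) (prefix : DescendingPrefix u t)
      {m′ m : Fin n} (m≡1+m′ : toℕ m ≡ suc (toℕ m′)) (t≤m′ : t ≤ toℕ m′) (uₘ≡c : val u m ≡ c) where

      m′<m : toℕ m′ < toℕ m
      m′<m = subst (toℕ m′ <_) (sym m≡1+m′) (n<1+n _)

      -- otherwise m′ is a cut, and the values u(t) ≤ … ≤ c would all stay left of it
      m≤h : toℕ m ≤ toℕ (h m′)
      m≤h = ≮⇒≥ λ h<m → m′-no-cut (≤-antisym (≤-pred (subst (toℕ (h m′) <_) m≡1+m′ h<m)) (proj₂ hess m′))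
        where
        pₜ : Fin n
        pₜ = fromℕ< t<n
        m′-no-cut : IsCut m′ → ⊥
        m′-no-cut cut with value-left-of-cut u u-perm closed cut (c ∸ val u pₜ) pₜ
                             (subst (_≤ toℕ m′) (sym (toℕ-fromℕ< t<n)) t≤m′)
                             (m+[n∸m]≡n (prefix-bound u u-perm t prefix pₜ (≤-reflexive (sym (toℕ-fromℕ< t<n)))))
                             (∸-suc-< t<n)
        ... | q , u_q≡c , q≤m′ =
          <⇒≱ m′<m (subst (λ z → toℕ z ≤ toℕ m′) (val-injective u u-perm (trans u_q≡c (sym uₘ≡c))) q≤m′)

      u′ : Word n
      u′ = swap u m′ m

      step : hBruhatStep h u u′
      step = m′ , m , m′<m , m≤h , refl , inv-swap-< u m′<m (subst (val u m′ <_) (sym uₘ≡c) uₘ′<c)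
        where
        uₘ′<c : val u m′ < c
        uₘ′<c = ≤∧≢⇒< (prefix-bound u u-perm t prefix m′ t≤m′)
                      (λ e → <⇒≢ᶠ m′<m (val-injective u u-perm (trans e (sym uₘ≡c))))

      closed′ : CutsClosed u′
      closed′ i p q cut p≤i u′q≡1+u′p = proj₂ (adjacent-transpose-side m≡1+m′ i≢m′ q) σq≤i
        where
        i≢m′ : toℕ i ≢ toℕ m′
        i≢m′ e = <⇒≱ m′<m (subst (λ z → toℕ m ≤ toℕ z) (toℕ-injective e)
                   (≤-trans (subst (λ z → toℕ m ≤ toℕ (h z)) (sym (toℕ-injective e)) m≤h) (≤-reflexive cut)))
        σq≤i : toℕ (transpose m′ m q) ≤ toℕ i
        σq≤i = closed i (transpose m′ m p) (transpose m′ m q) cut (proj₁ (adjacent-transpose-side m≡1+m′ i≢m′ p) p≤i)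
                 (trans (sym (cong toℕ (lookup-swap u m′ m q)))
                   (trans u′q≡1+u′p (cong suc (cong toℕ (lookup-swap u m′ m p)))))

      prefix′ : DescendingPrefix u′ t
      prefix′ s s<t = trans (val-swap-other u m′ m (beyond t≤m′) (beyond (≤-trans t≤m′ (<⇒≤ m′<m)))) (prefix s s<t)
        where
        beyond : ∀ {z} → t ≤ toℕ z → s ≢ z
        beyond t≤z refl = <⇒≱ s<t t≤z

      uₘ′′≡c : val u′ m′ ≡ c
      uₘ′′≡c = trans (val-swapˡ u m′ m) uₘ≡c

    place : ∀ d u (m : Fin n) → toℕ m ≡ t + d → IsPerm u → CutsClosed u → DescendingPrefix u t → val u m ≡ c →
      Reachable u (suc t)
    place zero u m m≡t+0 u-perm closed prefix uₘ≡c =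
      record { target = u ; chain = ε ; perm = u-perm ; closed = closed ; prefix = prefix′ }
      where
      m≡t : toℕ m ≡ t
      m≡t = trans m≡t+0 (+-identityʳ t)
      prefix′ : DescendingPrefix u (suc t)
      prefix′ s (s≤s s≤t) with <-cmp (toℕ s) t
      ... | tri< s<t _ _ = prefix s s<t
      ... | tri> _ _ t<s = ⊥-elim (<⇒≱ t<s s≤t)
      ... | tri≈ _ s≡t _ rewrite toℕ-injective {i = s} {j = m} (trans s≡t (sym m≡t)) =
        trans uₘ≡c (cong (λ z → n ∸ suc z) (sym m≡t))
    place (suc d) u m m≡t+1+d u-perm closed prefix uₘ≡c =
      record { Reachable rest ; chain = step ◅ Reachable.chain rest }
      where
      m′<n : t + d < n
      m′<n = <-trans (subst (t + d <_) (trans (sym (+-suc t d)) (sym m≡t+1+d)) (n<1+n (t + d))) (toℕ<n m)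
      m′ : Fin n
      m′ = fromℕ< m′<n
      m≡1+m′ : toℕ m ≡ suc (toℕ m′)
      m≡1+m′ = trans m≡t+1+d (trans (+-suc t d) (cong suc (sym (toℕ-fromℕ< m′<n))))
      t≤m′ : t ≤ toℕ m′
      t≤m′ = subst (t ≤_) (sym (toℕ-fromℕ< m′<n)) (m≤m+n t d)
      open Swap u u-perm closed prefix m≡1+m′ t≤m′ uₘ≡c
      rest : Reachable u′ (suc t)
      rest = place d u′ m′ (toℕ-fromℕ< m′<n) (IsPerm-swap u m′ m u-perm) closed′ prefix′ uₘ′′≡c

  descend : ∀ e t u → t + e ≡ n → IsPerm u → CutsClosed u → DescendingPrefix u t → u ≼[ h ] w₀
  descend zero t u t+0≡n u-perm closed prefix = subst (u ≼[ h ]_) u≡w₀ ε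
    where
    t≡n : t ≡ n
    t≡n = trans (sym (+-identityʳ t)) t+0≡n
    u≡w₀ : u ≡ w₀
    u≡w₀ = word-ext λ s → toℕ-injective (trans (prefix s (subst (toℕ s <_) (sym t≡n) (toℕ<n s)))
             (sym (trans (cong toℕ (lookup∘tabulate opposite s)) (opposite-prop s))))
  descend (suc e) t u t+1+e≡n u-perm closed prefix = place-value (IsPerm⇒surjective u u-perm (fromℕ< (∸-suc-< t<n)))
    where
    t<n : t < n
    t<n = subst (t <_) t+1+e≡n (m<m+n t (s≤s z≤n))
    open Placing t t<n
    place-value : ∃[ m ] lookup u m ≡ fromℕ< (∸-suc-< t<n) → u ≼[ h ] w₀
    place-value (m , uₘ≡c) = Reachable.chain placed ◅◅
        descend e (suc t) _ (trans (sym (+-suc t e)) t+1+e≡n)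
          (Reachable.perm placed) (Reachable.closed placed) (Reachable.prefix placed)
      where
      uₘ≡c′ : val u m ≡ c
      uₘ≡c′ = trans (cong toℕ uₘ≡c) (toℕ-fromℕ< _)
      t≤m : t ≤ toℕ m
      t≤m = ≮⇒≥ λ m<t → <-irrefl (trans (sym (∸-involutive (<-trans m<t t<n)))
              (trans (cong (λ z → n ∸ suc z) (trans (sym (prefix m m<t)) uₘ≡c′)) (∸-involutive t<n))) m<t
      placed : Reachable u (suc t)
      placed = place (toℕ m ∸ t) u m (sym (m+[n∸m]≡n t≤m)) u-perm closed prefix uₘ≡c′

  generator-≼[h]-w₀ : ∀ {w} → IsPerm w → IsGenerator h w → w ≼[ h ] w₀
  generator-≼[h]-w₀ {w} w-perm gen = descend n 0 w refl w-perm (generator⇒CutsClosed {w} gen) (λ s ())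

theorem3p8 : (n : ℕ) (h : Fin n → Fin n) (w : Word n) →
    IsHessenberg h → IsPerm w → IsGenerator h w →
    ((u v : Word n) → w ≼ u → u ≼ w₀ → w ≼ v → v ≼ w₀ →
      u ≼[ h ] v → CardLe w h u v)
    × CardLe w h w w₀
theorem3p8 n h w hess w-perm gen =
  (λ u v w≼u _ _ _ u≼[h]v → CardLe-≼[h] h hess w w-perm w≼u u≼[h]v) ,
  CardLe-≼[h] h hess w w-perm ε (GeneratorChain.generator-≼[h]-w₀ h hess w-perm gen)
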